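{- There is an absolute constant $c$ such that every tree $T$ with $n$ vertices and maximum degree $\Delta$ satisfies $st(T) \le c \cdot \min(\Delta^2 n, n^2)$.
   Context: A sorting network is a triple $\mathcal{S}(H,M,\pi)$ where: $H$ is a connected labeled graph on $n$ vertices; $\pi$ is a sorted order, i.e. a bijection assigning to each vertex $i$ a rank $\pi(i) \in \{1,\dots,n\}$; each vertex initially holds a pebble with a value; $M = (m_1,\dots,m_{|M|})$ is a sequence of directed matchings of $H$ (matchings in which some edges are given an orientation). At stage $t$ the matching $m_t$ is applied: for an oriented edge $\overrightarrow{uv}$ the smaller of the two pebbles is placed at $u$ and the larger at $v$; for an unoriented matched edge the two pebbles are swapped unconditionally. It is required that for every initial arrangement of the pebbles, after all $|M|$ stages vertex $i$ holds the pebble of rank $\pi(i)$; and every edge of $H$ belongs to some matching in $M$. $|M|$ is the depth. A sorting network on $G$ is one whose graph $H$ is a spanning subgraph of $G$. The sorting number $st(G)$ is the minimum depth of a sorting network on $G$ over all spanning subgraphs and sorted orders. -}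

module Defs where

open import Data.Nat using (ℕ; zero; suc; _+_; _*_; _≤_; _≤ᵇ_; _⊔_; _⊓_)
open import Data.Bool using (Bool; true; false; if_then_else_)
open import Data.Fin using (Fin; toℕ; _≟_)
open import Data.Fin.Permutation using (Permutation′; _⟨$⟩ʳ_)
open import Data.List using (List; []; _∷_; _++_; length; foldl; foldr; map; concatMap; allFin)
open import Data.Nat.ListAction using (sum)
open import Data.List.Relation.Unary.All using (All)
open import Data.List.Relation.Unary.Any using (Any)
open import Data.List.Relation.Unary.Linked using (Linked)
open import Data.List.Relation.Unary.Unique.Propositional using (Unique)
open import Data.Product using (_×_; Σ; ∃)
open import Data.Sum using (_⊎_)
open import Relation.Nullary using (¬_; does)
open import Relation.Binary.PropositionalEquality using (_≡_)

record Graph (n : ℕ) : Set where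
  field
    adj     : Fin n → Fin n → Bool
    sym     : ∀ u v → adj u v ≡ adj v u
    irrefl  : ∀ u → adj u u ≡ false

open Graph public

E : ∀ {n} → Graph n → Fin n → Fin n → Set
E G u v = adj G u v ≡ true

data Reach {n} (G : Graph n) : Fin n → Fin n → Set where
  here : ∀ {u} → Reach G u u
  step : ∀ {u v w} → E G u v → Reach G v w → Reach G u w

Connected : ∀ {n} → Graph n → Set
Connected {n} G = ∀ (u v : Fin n) → Reach G u v

IsCycle : ∀ {n} → Graph n → Fin n → List (Fin n) → Set
IsCycle G x ys = (2 ≤ length ys) × Unique (x ∷ ys) × Linked (E G) (x ∷ ys ++ x ∷ [])

Acyclic : ∀ {n} → Graph n → Set
Acyclic {n} G = ∀ (x : Fin n) (ys : List (Fin n)) → ¬ IsCycle G x ys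

IsTree : ∀ {n} → Graph n → Set
IsTree G = Connected G × Acyclic G

count : ∀ {n} → (Fin n → Bool) → ℕ
count {n} p = sum (map (λ u → if p u then 1 else 0) (allFin n))

degree : ∀ {n} → Graph n → Fin n → ℕ
degree G v = count (adj G v)

maxDegree : ∀ {n} → Graph n → ℕ
maxDegree {n} G = foldr _⊔_ 0 (map (degree G) (allFin n))

SpanningSubgraph : ∀ {n} → Graph n → Graph n → Set
SpanningSubgraph {n} H G = ∀ (u v : Fin n) → E H u v → E G u v

-- a matched edge {u,v}; if oriented = true it is the oriented edge u→v
-- (smaller pebble to u, larger to v); otherwise an unconditional swap
record MEdge (n : ℕ) : Set where
  constructor medge
  field
    src      : Fin n
    tgt      : Fin n
    oriented : Bool

open MEdge public

Stage : ℕ → Set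
Stage n = List (MEdge n)

endpoints : ∀ {n} → Stage n → List (Fin n)
endpoints = concatMap (λ e → src e ∷ tgt e ∷ [])

IsDirectedMatching : ∀ {n} → Graph n → Stage n → Set
IsDirectedMatching H m = All (λ e → E H (src e) (tgt e)) m × Unique (endpoints m)

-- configuration: vertex ↦ rank (in Fin n, i.e. 0-based) of the pebble it holds
Config : ℕ → Set
Config n = Fin n → Fin n

minF maxF : ∀ {n} → Fin n → Fin n → Fin n
minF a b = if toℕ a ≤ᵇ toℕ b then a else b
maxF a b = if toℕ a ≤ᵇ toℕ b then b else a

applyEdge : ∀ {n} → Config n → MEdge n → Config n
applyEdge c (medge u v true) w =
  if does (w ≟ u) then minF (c u) (c v)
  else if does (w ≟ v) then maxF (c u) (c v) else c w
applyEdge c (medge u v false) w =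
  if does (w ≟ u) then c v
  else if does (w ≟ v) then c u else c w

-- the edges of a matching are disjoint, so applying them one after the
-- other is the same as applying them simultaneously
applyStage : ∀ {n} → Config n → Stage n → Config n
applyStage = foldl applyEdge

run : ∀ {n} → List (Stage n) → Config n → Config n
run M c = foldl applyStage c M

IsEdge : ∀ {n} → Fin n → Fin n → MEdge n → Set
IsEdge u v e = (src e ≡ u × tgt e ≡ v) ⊎ (src e ≡ v × tgt e ≡ u)

record SortingNetwork {n} (G : Graph n) : Set where
  field
    H         : Graph n
    spanning  : SpanningSubgraph H G
    connected : Connected H
    π         : Permutation′ n          -- sorted order: vertex i gets rank π(i)
    M         : List (Stage n)
    matchings : All (IsDirectedMatching H) M
    sorts     : ∀ (σ : Permutation′ n) (i : Fin n) → run M (σ ⟨$⟩ʳ_) i ≡ π ⟨$⟩ʳ i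
    covers    : ∀ (u v : Fin n) → E H u v → Any (Any (IsEdge u v)) M

open SortingNetwork public

depth : ∀ {n} {G : Graph n} → SortingNetwork G → ℕ
depth S = length (M S)

-- st(G) ≤ k  (st is a minimum over sorting networks on G)
StAtMost : ∀ {n} → Graph n → ℕ → Set
StAtMost G k = Σ (SortingNetwork G) (λ S → depth S ≤ k)

module Submission where

-- Take a breadth-first spanning tree of the (connected) graph and list its vertices by a
-- depth-first tour that puts each vertex before its subtree and its children after theirs,
-- alternating level by level; consecutive vertices of this tour are then at distance at most 3.
-- Run odd-even transposition sort along the tour: by the 0-1 principle 2N double rounds sort.
-- A comparator between consecutive tour vertices is simulated on a route of length at most 3
-- by swapping towards the far end, comparing, and swapping back (5 stages). Colouring a route
-- by the level of its top vertex mod 3, the kind of step and the rank of the child it enters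
-- among its siblings (fewer than Δ) makes routes of one colour vertex-disjoint, so a round
-- takes 9Δ·5 stages and the whole sort O(NΔ) ≤ O(min(Δ²N, N²)).

open import Defs hiding (sym)
open import Data.Bool using (Bool; true; false; if_then_else_; _∧_; _∨_; not; T)
open import Data.Bool.Properties using (∧-comm; ∨-comm; ∧-zeroʳ; ∨-zeroʳ; T-≡; not-¬)
  renaming (_≟_ to _≟ᵇ_)
open import Data.Empty using (⊥; ⊥-elim)
open import Data.Nat using (ℕ; zero; suc; pred; _≤′_; ≤′-refl; ≤′-step; _+_; _*_; _∸_; _≤_; _<_; _≤ᵇ_; _<ᵇ_; z≤n; s≤s; _⊓_; _⊔_)
import Data.Nat as ℕ
open import Data.Nat.Properties hiding (_≟_)
open import Data.Nat.ListAction using (sum)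
open import Data.Nat.Tactic.RingSolver using (solve-∀)
open import Data.Fin using (Fin; toℕ; _≟_; fromℕ<)
import Data.Fin as Fin
open import Data.Fin.Properties using (any?; toℕ-injective; toℕ-fromℕ<; toℕ<n)
open import Data.Fin.Permutation using (Permutation′; _⟨$⟩ʳ_; _⟨$⟩ˡ_; permutation; inverseˡ; inverseʳ)
import Data.Fin.Permutation as Permutation
open import Data.List using (List; []; _∷_; _++_; foldl; foldr; length; map; zipWith; concatMap; filter; allFin; upTo)
open import Data.List.Properties using (foldl-++; length-tabulate; ++-identityʳ; concatMap-++; map-++; length-++; length-upTo)
open import Data.List.Membership.Propositional using (_∈_; find; lose)
open import Data.List.Membership.Propositional.Properties
  using (∈-++⁺ˡ; ∈-++⁺ʳ; ∈-++⁻; ∈-allFin; ∈-filter⁺; ∈-filter⁻; ∈-concatMap⁺; ∈-concatMap⁻; ∈-upTo⁺)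
open import Data.List.Membership.Propositional.Properties.WithK using (unique∧set⇒bag)
open import Data.List.Relation.Unary.All using (All; []; _∷_)
import Data.List.Relation.Unary.All as All
import Data.List.Relation.Unary.All.Properties as AllP
open import Data.List.Relation.Unary.Any using (Any; here; there)
import Data.List.Relation.Unary.Any.Properties as AnyP
open import Data.List.Relation.Unary.AllPairs using (AllPairs; []; _∷_)
open import Data.List.Relation.Unary.Linked using (Linked; []; [-]; _∷_)
open import Data.List.Relation.Unary.Linked.Properties using (AllPairs⇒Linked)
open import Data.List.Relation.Unary.Unique.Propositional using (Unique)
import Data.List.Relation.Unary.Unique.Propositional.Properties as Unique
open import Data.List.Relation.Binary.Disjoint.Propositional using (Disjoint)
open import Data.List.Relation.Binary.BagAndSetEquality using (∼bag⇒↭)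
open import Data.List.Relation.Binary.Permutation.Propositional.Properties using (↭-length)
open import Data.Product using (Σ; ∃; _×_; _,_; proj₁; proj₂)
open import Data.Sum using (_⊎_; inj₁; inj₂)
open import Function using (_∘_; case_of_)
open import Function.Bundles using (Equivalence; mk⇔)
open import Relation.Nullary using (¬_; Dec; does; yes; no; contradiction; _×-dec_)
open import Relation.Nullary.Decidable using (dec-true; dec-false)
open import Relation.Nullary.Reflects using (ofʸ; ofⁿ)
open import Relation.Unary using (Decidable)
open import Relation.Binary.Definitions using (tri<; tri≈; tri>)
open import Relation.Binary.PropositionalEquality

private variable
  m : ℕ

T⇒≡true : ∀ {b} → T b → b ≡ true
T⇒≡true = Equivalence.to T-≡

≡true⇒T : ∀ {b} → b ≡ true → T b
≡true⇒T = Equivalence.from T-≡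

∧-absorbs-implied : ∀ {x y} → (x ≡ true → y ≡ true) → x ∧ y ≡ x
∧-absorbs-implied {false} _ = refl
∧-absorbs-implied {true} x⇒y = x⇒y refl

∨-absorbs-implying : ∀ {x y} → (x ≡ true → y ≡ true) → x ∨ y ≡ y
∨-absorbs-implying {false} _ = refl
∨-absorbs-implying {true} x⇒y = sym (x⇒y refl)

from-does : ∀ {A : Set} (a? : Dec A) → does a? ≡ true → A
from-does (yes a) _ = a

∧-true : ∀ a {b} → a ∧ b ≡ true → a ≡ true × b ≡ true
∧-true true b≡true = refl , b≡true

bit : Bool → ℕ
bit b = if b then 1 else 0

bit≤1 : ∀ b → bit b ≤ 1
bit≤1 true = ≤-refl
bit≤1 false = z≤n

sumRange : (ℕ → ℕ) → ℕ → ℕ → ℕ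
sumRange f i zero = 0
sumRange f i (suc l) = f i + sumRange f (suc i) l

sumRange-+ : ∀ f g i l → sumRange (λ j → f j + g j) i l ≡ sumRange f i l + sumRange g i l
sumRange-+ f g i zero = refl
sumRange-+ f g i (suc l) rewrite sumRange-+ f g (suc i) l = +-interchange (f i) (g i) _ _
  where
  +-interchange : ∀ a b c d → a + b + (c + d) ≡ a + c + (b + d)
  +-interchange = solve-∀

private
  range-step : ∀ {i j l} → j < suc i + l → j < i + suc l
  range-step {i} {j} {l} = subst (j <_) (sym (+-suc i l))

sumRange-cong : ∀ f g i l → (∀ j → i ≤ j → j < i + l → f j ≡ g j) → sumRange f i l ≡ sumRange g i l
sumRange-cong f g i zero h = refl
sumRange-cong f g i (suc l) h =
  cong₂ _+_ (h i ≤-refl (range-step (s≤s (m≤m+n i l))))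
            (sumRange-cong f g (suc i) l (λ j i<j j<end → h j (<⇒≤ i<j) (range-step j<end)))

sumRange-zero : ∀ f i l → (∀ j → i ≤ j → j < i + l → f j ≡ 0) → sumRange f i l ≡ 0
sumRange-zero f i zero h = refl
sumRange-zero f i (suc l) h =
  cong₂ _+_ (h i ≤-refl (range-step (s≤s (m≤m+n i l))))
            (sumRange-zero f (suc i) l (λ j i<j j<end → h j (<⇒≤ i<j) (range-step j<end)))

sumRange-single : ∀ f i l j₀ → i ≤ j₀ → j₀ < i + l → f j₀ ≡ 1 →
                  (∀ j → i ≤ j → j < i + l → j ≢ j₀ → f j ≡ 0) → sumRange f i l ≡ 1
sumRange-single f i zero j₀ i≤j₀ j₀<i+0 _ _ = contradiction (subst (j₀ <_) (+-identityʳ i) j₀<i+0) (≤⇒≯ i≤j₀)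
sumRange-single f i (suc l) j₀ i≤j₀ j₀<end f₁ others with i ℕ.≟ j₀
... | yes refl = cong₂ _+_ f₁
      (sumRange-zero f (suc i) l (λ j i<j j<end → others j (<⇒≤ i<j) (range-step j<end) (>⇒≢ i<j)))
... | no i≢j₀ = cong₂ _+_ (others i ≤-refl (range-step (s≤s (m≤m+n i l))) i≢j₀)
      (sumRange-single f (suc i) l j₀ (≤∧≢⇒< i≤j₀ i≢j₀) (subst (j₀ <_) (+-suc i l) j₀<end) f₁
                       (λ j i<j j<end → others j (<⇒≤ i<j) (range-step j<end)))

least : (ℕ → Bool) → ℕ → ℕ
least P zero = 0
least P (suc b) = if P 0 then 0 else suc (least (P ∘ suc) b)

least-holds : ∀ (P : ℕ → Bool) b → P b ≡ true → P (least P b) ≡ true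
least-holds P zero Pb = Pb
least-holds P (suc b) Pb with P 0 in P0
... | true = P0
... | false = least-holds (P ∘ suc) b Pb

least-≤ : ∀ (P : ℕ → Bool) b d → P d ≡ true → least P b ≤ d
least-≤ P zero d _ = z≤n
least-≤ P (suc b) d Pd with P 0 in P0
... | true = z≤n
least-≤ P (suc b) zero Pd | false with trans (sym P0) Pd
...   | ()
least-≤ P (suc b) (suc d) Pd | false = s≤s (least-≤ (P ∘ suc) b d Pd)

<least⇒false : ∀ (P : ℕ → Bool) b d → d < least P b → P d ≡ false
<least⇒false P (suc b) d d<least with P 0 in P0
<least⇒false P (suc b) zero _ | false = P0
<least⇒false P (suc b) (suc d) (s≤s d<least) | false = <least⇒false (P ∘ suc) b d d<least

concatMap-unique : ∀ {A B : Set} (g : A → List B) {xs} → Unique xs → All (Unique ∘ g) xs →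
                   (∀ {c c′} → c ∈ xs → c′ ∈ xs → c ≢ c′ → Disjoint (g c) (g c′)) →
                   Unique (concatMap g xs)
concatMap-unique g {[]} _ _ _ = []
concatMap-unique g {y ∷ ys} (y∉ys ∷ ys!) (gy! ∷ gys!) disjoint =
  Unique.++⁺ gy! (concatMap-unique g ys! gys! (λ c∈ c′∈ → disjoint (there c∈) (there c′∈)))
                 (λ (x∈gy , x∈rest) → apart (λ c∈ → c∈) y∉ys x∈gy x∈rest)
  where
  apart : ∀ {zs} → (∀ {z} → z ∈ zs → z ∈ ys) → All (y ≢_) zs → ∀ {x} → x ∈ g y → x ∈ concatMap g zs → ⊥
  apart {z ∷ zs} ⊆ys (y≢z ∷ y≢zs) x∈gy x∈ with ∈-++⁻ (g z) x∈
  ... | inj₁ x∈gz = disjoint (here refl) (there (⊆ys (here refl))) y≢z (x∈gy , x∈gz)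
  ... | inj₂ x∈rest = apart (⊆ys ∘ there) y≢zs x∈gy x∈rest

length-concatMap≤ : ∀ {A B : Set} (g : A → List B) {k} → (∀ x → length (g x) ≤ k) → ∀ xs →
                    length (concatMap g xs) ≤ length xs * k
length-concatMap≤ g g≤k [] = z≤n
length-concatMap≤ g g≤k (x ∷ xs) = ≤-trans (≤-reflexive (length-++ (g x))) (+-mono-≤ (g≤k x) (length-concatMap≤ g g≤k xs))

∸∸-≤ᵇ : ∀ {N k j} → j < N → (N ∸ (N ∸ k) ≤ᵇ j) ≡ (k ≤ᵇ j)
∸∸-≤ᵇ {N} {k} {j} j<N with k ≤? N
... | yes k≤N = cong (_≤ᵇ j) (m∸[m∸n]≡n k≤N)
... | no k≰N = begin
  N ∸ (N ∸ k) ≤ᵇ j   ≡⟨ cong (λ d → N ∸ d ≤ᵇ j) (m≤n⇒m∸n≡0 (<⇒≤ (≰⇒> k≰N))) ⟩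
  N ≤ᵇ j             ≡⟨ dec-false (N ≤? j) (<⇒≱ j<N) ⟩
  false              ≡⟨ dec-false (k ≤? j) (λ k≤j → k≰N (≤-trans k≤j (<⇒≤ j<N))) ⟨
  k ≤ᵇ j             ∎
  where open ≡-Reasoning

sum-bits≤length : ∀ {A : Set} (b : A → Bool) xs → sum (map (bit ∘ b) xs) ≤ length xs
sum-bits≤length b [] = z≤n
sum-bits≤length b (x ∷ xs) = +-mono-≤ (bit≤1 (b x)) (sum-bits≤length b xs)

maximum≤ : ∀ {A : Set} (f : A → ℕ) {k} → (∀ x → f x ≤ k) → ∀ xs → foldr _⊔_ 0 (map f xs) ≤ k
maximum≤ f f≤k [] = z≤n
maximum≤ f f≤k (x ∷ xs) = ⊔-lub (f≤k x) (maximum≤ f f≤k xs)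

AllPairs-tabulate : ∀ {A : Set} {R : A → A → Set} {xs} → Unique xs →
                    (∀ {a b} → a ∈ xs → b ∈ xs → a ≢ b → R a b) → AllPairs R xs
AllPairs-tabulate {xs = []} _ _ = []
AllPairs-tabulate {xs = x ∷ xs} (x∉ ∷ xs!) R-apart =
  All.tabulate (λ y∈ → R-apart (here refl) (there y∈) (All.lookup x∉ y∈)) ∷
  AllPairs-tabulate xs! (λ a∈ b∈ → R-apart (there a∈) (there b∈))

≤-maximum : ∀ {A : Set} (f : A → ℕ) {xs x} → x ∈ xs → f x ≤ foldr _⊔_ 0 (map f xs)
≤-maximum f (here refl) = m≤m⊔n _ _
≤-maximum f (there x∈) = ≤-trans (≤-maximum f x∈) (m≤n⊔m _ _)

lastOr : ∀ {A : Set} → A → List A → A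
lastOr x [] = x
lastOr x (y ∷ ys) = lastOr y ys

nthOr : ∀ {A : Set} → A → List A → ℕ → A
nthOr d [] i = d
nthOr d (x ∷ xs) zero = x
nthOr d (x ∷ xs) (suc i) = nthOr d xs i

module _ {A : Set} (d : A) where

  nthOr-∈ : ∀ xs {i} → i < length xs → nthOr d xs i ∈ xs
  nthOr-∈ (x ∷ xs) {zero} _ = here refl
  nthOr-∈ (x ∷ xs) {suc i} (s≤s i<) = there (nthOr-∈ xs i<)

  nthOr-injective : ∀ {xs} → Unique xs → ∀ {i j} → i < length xs → j < length xs →
                    nthOr d xs i ≡ nthOr d xs j → i ≡ j
  nthOr-injective {x ∷ xs} _ {zero} {zero} _ _ _ = refl
  nthOr-injective {x ∷ xs} (x∉ ∷ _) {zero} {suc j} _ (s≤s j<) x≡ =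
    contradiction (sym x≡) (All.lookup x∉ (nthOr-∈ xs j<) ∘ sym)
  nthOr-injective {x ∷ xs} (x∉ ∷ _) {suc i} {zero} (s≤s i<) _ x≡ =
    contradiction x≡ (All.lookup x∉ (nthOr-∈ xs i<) ∘ sym)
  nthOr-injective {x ∷ xs} (_ ∷ xs!) {suc i} {suc j} (s≤s i<) (s≤s j<) ≡ =
    cong suc (nthOr-injective xs! i< j< ≡)

  ∈⇒nthOr : ∀ {xs x} → x ∈ xs → ∃ λ i → i < length xs × nthOr d xs i ≡ x
  ∈⇒nthOr (here refl) = 0 , s≤s z≤n , refl
  ∈⇒nthOr (there x∈) with ∈⇒nthOr x∈
  ... | i , i< , ≡x = suc i , s≤s i< , ≡x

  nthOr-Linked : ∀ {R : A → A → Set} {xs} → Linked R xs → ∀ {i} → suc i < length xs →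
                 R (nthOr d xs i) (nthOr d xs (suc i))
  nthOr-Linked [-] {_} (s≤s ())
  nthOr-Linked (r ∷ _) {zero} _ = r
  nthOr-Linked (_ ∷ rs) {suc i} (s≤s i+1<) = nthOr-Linked rs i+1<

module _ {A : Set} {P Q : A → Set} (P? : Decidable P) (Q? : Decidable Q) (P⇒Q : ∀ {x} → P x → Q x) where

  length-filter-mono : ∀ xs → length (filter P? xs) ≤ length (filter Q? xs)
  length-filter-mono [] = z≤n
  length-filter-mono (x ∷ xs) with P? x | Q? x
  ... | yes _ | yes _ = s≤s (length-filter-mono xs)
  ... | yes p | no ¬q = contradiction (P⇒Q p) ¬q
  ... | no _ | yes _ = m≤n⇒m≤1+n (length-filter-mono xs)
  ... | no _ | no _ = length-filter-mono xs

  length-filter-< : ∀ {xs x} → x ∈ xs → Q x → ¬ P x → length (filter P? xs) < length (filter Q? xs)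
  length-filter-< {y ∷ xs} x∈ q ¬p with P? y | Q? y | x∈
  ... | yes p | _ | here refl = contradiction p ¬p
  ... | _ | no ¬q | here refl = contradiction q ¬q
  ... | no _ | yes _ | here refl = s≤s (length-filter-mono xs)
  ... | yes p | no ¬q | there _ = contradiction (P⇒Q p) ¬q
  ... | yes _ | yes _ | there x∈′ = s≤s (length-filter-< x∈′ q ¬p)
  ... | no _ | yes _ | there x∈′ = m≤n⇒m≤1+n (length-filter-< x∈′ q ¬p)
  ... | no _ | no _ | there x∈′ = length-filter-< x∈′ q ¬p

length-filter≤sum : ∀ {A : Set} {P : A → Set} (P? : Decidable P) (b : A → Bool) →
                    (∀ {x} → P x → b x ≡ true) → ∀ xs → length (filter P? xs) ≤ sum (map (bit ∘ b) xs)
length-filter≤sum P? b P⇒b [] = z≤n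
length-filter≤sum P? b P⇒b (x ∷ xs) with P? x | b x in bx
... | yes _ | true = s≤s (length-filter≤sum P? b P⇒b xs)
... | yes p | false with trans (sym (P⇒b p)) bx
...   | ()
length-filter≤sum P? b P⇒b (x ∷ xs) | no _ | true = m≤n⇒m≤1+n (length-filter≤sum P? b P⇒b xs)
length-filter≤sum P? b P⇒b (x ∷ xs) | no _ | false = length-filter≤sum P? b P⇒b xs

mod3 : ℕ → ℕ
mod3 zero = 0
mod3 (suc d) = next (mod3 d)
  where
  next : ℕ → ℕ
  next 0 = 1
  next 1 = 2
  next _ = 0

mod3<3 : ∀ d → mod3 d < 3
mod3<3 zero = s≤s z≤n
mod3<3 (suc d) with mod3 d | mod3<3 d
... | 0 | _ = s≤s (s≤s z≤n)
... | 1 | _ = s≤s (s≤s (s≤s z≤n))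
... | 2 | _ = s≤s z≤n
... | suc (suc (suc _)) | s≤s (s≤s (s≤s ()))

private
  mod3-suc≢ : ∀ d → mod3 (suc d) ≢ mod3 d
  mod3-suc≢ d with mod3 d | mod3<3 d
  ... | 0 | _ = λ ()
  ... | 1 | _ = λ ()
  ... | 2 | _ = λ ()
  ... | suc (suc (suc _)) | s≤s (s≤s (s≤s ()))

  mod3-2+≢ : ∀ d → mod3 (suc (suc d)) ≢ mod3 d
  mod3-2+≢ d with mod3 d | mod3<3 d
  ... | 0 | _ = λ ()
  ... | 1 | _ = λ ()
  ... | 2 | _ = λ ()
  ... | suc (suc (suc _)) | s≤s (s≤s (s≤s ()))

mod3-cancel : ∀ {a a′ d d′} → a ≤ 2 → a′ ≤ 2 → a + d ≡ a′ + d′ → mod3 d ≡ mod3 d′ → a ≡ a′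
mod3-cancel {0} {0} _ _ _ _ = refl
mod3-cancel {1} {1} _ _ _ _ = refl
mod3-cancel {2} {2} _ _ _ _ = refl
mod3-cancel {0} {1} {d′ = d′} _ _ refl d≡ = contradiction d≡ (mod3-suc≢ d′)
mod3-cancel {1} {0} {d} _ _ refl d≡ = contradiction (sym d≡) (mod3-suc≢ d)
mod3-cancel {0} {2} {d′ = d′} _ _ refl d≡ = contradiction d≡ (mod3-2+≢ d′)
mod3-cancel {2} {0} {d} _ _ refl d≡ = contradiction (sym d≡) (mod3-2+≢ d)
mod3-cancel {1} {2} {d′ = d′} _ _ refl d≡ = contradiction d≡ (mod3-suc≢ d′)
mod3-cancel {2} {1} {d} _ _ refl d≡ = contradiction (sym d≡) (mod3-suc≢ d)
mod3-cancel {suc (suc (suc _))} (s≤s (s≤s ())) _ _ _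
mod3-cancel {a′ = suc (suc (suc _))} _ (s≤s (s≤s ())) _ _

private
  three≤ : ∀ a b → 3 ≤ a + 3 * suc b
  three≤ a b = ≤-trans (m≤m+n 3 (3 * b)) (≤-trans (≤-reflexive (sym (*-suc 3 b))) (m≤n+m _ a))

  base3-digit : ∀ {a b a′ b′} → a < 3 → a′ < 3 → a + 3 * b ≡ a′ + 3 * b′ → a ≡ a′ × b ≡ b′
  base3-digit {b = zero} {b′ = zero} _ _ e = trans (sym (+-identityʳ _)) (trans e (+-identityʳ _)) , refl
  base3-digit {a} {suc b} {a′} {zero} _ a′<3 e = contradiction (trans e (+-identityʳ a′)) (>⇒≢ (≤-trans a′<3 (three≤ a b)))
  base3-digit {a} {zero} {a′} {suc b′} a<3 _ e = contradiction (trans (sym e) (+-identityʳ a)) (>⇒≢ (≤-trans a<3 (three≤ a′ b′)))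
  base3-digit {a} {suc b} {a′} {suc b′} a<3 a′<3 e with base3-digit a<3 a′<3 (+-cancelˡ-≡ 3 _ _ (trans (sym (shift a b)) (trans e (shift a′ b′))))
    where
    shift : ∀ x y → x + 3 * suc y ≡ 3 + (x + 3 * y)
    shift = solve-∀
  ... | a≡a′ , b≡b′ = a≡a′ , cong suc b≡b′

base3-injective : ∀ {q t s q′ t′ s′} → q < 3 → t < 3 → q′ < 3 → t′ < 3 →
                  q + 3 * (t + 3 * s) ≡ q′ + 3 * (t′ + 3 * s′) → q ≡ q′ × t ≡ t′ × s ≡ s′
base3-injective q<3 t<3 q′<3 t′<3 e with base3-digit q<3 q′<3 e
... | q≡ , rest = q≡ , base3-digit t<3 t′<3 rest

base3-bound : ∀ {q t s D} → q < 3 → t < 3 → s < D → q + 3 * (t + 3 * s) < 9 * D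
base3-bound {q} {t} {s} {suc D} q<3 t<3 (s≤s s≤D) = begin-strict
  q + 3 * (t + 3 * s)        ≤⟨ +-mono-≤ (≤-pred q<3) (*-monoʳ-≤ 3 (+-mono-≤ (≤-pred t<3) (*-monoʳ-≤ 3 s≤D))) ⟩
  2 + 3 * (2 + 3 * D)        <⟨ n<1+n _ ⟩
  suc (2 + 3 * (2 + 3 * D))  ≡⟨ nine D ⟩
  9 * suc D                  ∎
  where
  open ≤-Reasoning
  nine : ∀ D → suc (2 + 3 * (2 + 3 * D)) ≡ 9 * suc D
  nine = solve-∀

-- The 0-1 principle

BoolConfig : ℕ → Set
BoolConfig m = Fin m → Bool

applyEdgeᵇ : BoolConfig m → MEdge m → BoolConfig m
applyEdgeᵇ c (medge u v true) w =
  if does (w ≟ u) then c u ∧ c v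
  else if does (w ≟ v) then c u ∨ c v else c w
applyEdgeᵇ c (medge u v false) w =
  if does (w ≟ u) then c v
  else if does (w ≟ v) then c u else c w

applyStageᵇ : BoolConfig m → Stage m → BoolConfig m
applyStageᵇ = foldl applyEdgeᵇ

runᵇ : List (Stage m) → BoolConfig m → BoolConfig m
runᵇ M c = foldl applyStageᵇ c M

threshold : ℕ → Fin m → Bool
threshold k x = k ≤ᵇ toℕ x

threshold-mono : ∀ k {a b : Fin m} → toℕ a ≤ toℕ b → threshold k a ≡ true → threshold k b ≡ true
threshold-mono k a≤b ka = T⇒≡true (≤⇒≤ᵇ (≤-trans (≤ᵇ⇒≤ k _ (≡true⇒T ka)) a≤b))

threshold-minF : ∀ k (a b : Fin m) → threshold k (minF a b) ≡ threshold k a ∧ threshold k b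
threshold-minF k a b with toℕ a ≤ᵇ toℕ b | ≤ᵇ-reflects-≤ (toℕ a) (toℕ b)
... | true | ofʸ a≤b = sym (∧-absorbs-implied (threshold-mono k a≤b))
... | false | ofⁿ a≰b = trans (sym (∧-absorbs-implied (threshold-mono k (≰⇒≥ a≰b)))) (∧-comm (threshold k b) (threshold k a))

threshold-maxF : ∀ k (a b : Fin m) → threshold k (maxF a b) ≡ threshold k a ∨ threshold k b
threshold-maxF k a b with toℕ a ≤ᵇ toℕ b | ≤ᵇ-reflects-≤ (toℕ a) (toℕ b)
... | true | ofʸ a≤b = sym (∨-absorbs-implying (threshold-mono k a≤b))
... | false | ofⁿ a≰b = trans (sym (∨-absorbs-implying (threshold-mono k (≰⇒≥ a≰b)))) (∨-comm (threshold k b) (threshold k a))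

ThresholdOf : ℕ → Config m → BoolConfig m → Set
ThresholdOf k c c′ = ∀ w → threshold k (c w) ≡ c′ w

threshold-applyEdge : ∀ k {c : Config m} {c′} → ThresholdOf k c c′ →
                      ∀ e → ThresholdOf k (applyEdge c e) (applyEdgeᵇ c′ e)
threshold-applyEdge k {c} t (medge u v true) w with does (w ≟ u)
... | true = trans (threshold-minF k (c u) (c v)) (cong₂ _∧_ (t u) (t v))
... | false with does (w ≟ v)
...   | true = trans (threshold-maxF k (c u) (c v)) (cong₂ _∨_ (t u) (t v))
...   | false = t w
threshold-applyEdge k t (medge u v false) w with does (w ≟ u)
... | true = t v
... | false with does (w ≟ v)
...   | true = t u
...   | false = t w

threshold-applyStage : ∀ k {c : Config m} {c′} → ThresholdOf k c c′ →
                       ∀ s → ThresholdOf k (applyStage c s) (applyStageᵇ c′ s)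
threshold-applyStage k t [] = t
threshold-applyStage k t (e ∷ s) = threshold-applyStage k (threshold-applyEdge k t e) s

threshold-run : ∀ k {c : Config m} {c′} → ThresholdOf k c c′ →
                ∀ M → ThresholdOf k (run M c) (runᵇ M c′)
threshold-run k t [] = t
threshold-run k t (s ∷ M) = threshold-run k (threshold-applyStage k t s) M

threshold-injective : {a b : Fin m} → (∀ k → threshold k a ≡ threshold k b) → a ≡ b
threshold-injective h = toℕ-injective (≤-antisym (below h) (below (λ k → sym (h k))))
  where
  below : {a b : Fin m} → (∀ k → threshold k a ≡ threshold k b) → toℕ a ≤ toℕ b
  below {a = a} h = ≤ᵇ⇒≤ (toℕ a) _ (≡true⇒T (trans (sym (h (toℕ a))) (T⇒≡true (≤⇒≤ᵇ (≤-refl {toℕ a})))))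

-- Odd-even transposition sort of a 0-1 sequence

module OddEvenTranspositionSort (N : ℕ) where

  Line : Set
  Line = ℕ → Bool

  odd : ℕ → Bool
  odd zero = false
  odd (suc i) = not (odd i)

  lowerEnd : Bool → ℕ → Bool
  lowerEnd r i = does (odd i ≟ᵇ r) ∧ (suc i <ᵇ N)

  upperEnd : Bool → ℕ → Bool
  upperEnd r zero = false
  upperEnd r (suc i) = lowerEnd r i

  round : Bool → Line → Line
  round r x i = if lowerEnd r i then x i ∧ x (suc i)
                else if upperEnd r i then x (pred i) ∨ x i else x i

  lowerEnd-suc : ∀ r i → lowerEnd r i ≡ true → lowerEnd r (suc i) ≡ false
  lowerEnd-suc r i h with odd i ≟ᵇ r
  ... | yes oddᵢ≡r = cong (_∧ (suc (suc i) <ᵇ N)) (dec-false (not (odd i) ≟ᵇ r) λ e → not-¬ (sym oddᵢ≡r) (sym e))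

  lowerEnd-pred : ∀ r i → lowerEnd r (suc i) ≡ true → lowerEnd r i ≡ false
  lowerEnd-pred r i h with lowerEnd r i in e
  ... | false = refl
  ... | true with trans (sym h) (lowerEnd-suc r i e)
  ...   | ()

  lowerEnd-bounded : ∀ r i → lowerEnd r i ≡ true → suc i < N
  lowerEnd-bounded r i h = <ᵇ⇒< (suc i) N (≡true⇒T (proj₂ (∧-true (does (odd i ≟ᵇ r)) h)))

  ones : Line → ℕ → ℕ → ℕ
  ones x = sumRange (bit ∘ x)

  onesFrom : Line → ℕ → ℕ
  onesFrom x i = ones x i (N ∸ i)

  -- the number of ones that round r moves from position i - 1 up to i
  crossing : Bool → Line → ℕ → ℕ
  crossing r x zero = 0
  crossing r x (suc i) = if lowerEnd r i then bit (x i ∧ not (x (suc i))) else 0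

  private
    bit-∧ : ∀ a b → bit (a ∧ b) + bit (a ∧ not b) ≡ bit a
    bit-∧ true true = refl
    bit-∧ true false = refl
    bit-∧ false b = refl

    bit-∨ : ∀ a b → bit (a ∨ b) ≡ bit b + bit (a ∧ not b)
    bit-∨ true true = refl
    bit-∨ true false = refl
    bit-∨ false true = refl
    bit-∨ false false = refl

  ones-conserved-at : ∀ r x i → bit (round r x i) + crossing r x (suc i) ≡ bit (x i) + crossing r x i
  ones-conserved-at r x zero with lowerEnd r zero
  ... | true = trans (bit-∧ (x 0) (x 1)) (sym (+-identityʳ _))
  ... | false = refl
  ones-conserved-at r x (suc i) with lowerEnd r (suc i) in e
  ... | true rewrite lowerEnd-pred r i e = trans (bit-∧ (x (suc i)) (x (suc (suc i)))) (sym (+-identityʳ _))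
  ... | false with lowerEnd r i
  ...   | true = trans (+-identityʳ _) (bit-∨ (x i) (x (suc i)))
  ...   | false = refl

  ones-round : ∀ r x l i → ones (round r x) i l + crossing r x (i + l) ≡ ones x i l + crossing r x i
  ones-round r x zero i = cong (crossing r x) (+-identityʳ i)
  ones-round r x (suc l) i = begin
      a + s + crossing r x (i + suc l)     ≡⟨ cong (λ j → a + s + crossing r x j) (+-suc i l) ⟩
      a + s + crossing r x (suc i + l)     ≡⟨ +-assoc a s _ ⟩
      a + (s + crossing r x (suc i + l))   ≡⟨ cong (a +_) (ones-round r x l (suc i)) ⟩
      a + (s′ + crossing r x (suc i))      ≡⟨ shuffle a s′ _ ⟩
      a + crossing r x (suc i) + s′        ≡⟨ cong (_+ s′) (ones-conserved-at r x i) ⟩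
      bit (x i) + crossing r x i + s′      ≡⟨ shuffle (bit (x i)) s′ _ ⟨
      bit (x i) + (s′ + crossing r x i)    ≡⟨ +-assoc (bit (x i)) s′ _ ⟨
      bit (x i) + s′ + crossing r x i      ∎
    where
    open ≡-Reasoning
    a = bit (round r x i)
    s = ones (round r x) (suc i) l
    s′ = ones x (suc i) l
    shuffle : ∀ a b c → a + (b + c) ≡ a + c + b
    shuffle = solve-∀

  crossing-beyond : ∀ r x i → N ≤ i → crossing r x i ≡ 0
  crossing-beyond r x zero _ = refl
  crossing-beyond r x (suc i) N≤1+i
    rewrite dec-false (suc i <? N) (≤⇒≯ N≤1+i) | ∧-zeroʳ (does (odd i ≟ᵇ r)) = refl

  onesFrom-round : ∀ r x i → onesFrom (round r x) i ≡ onesFrom x i + crossing r x i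
  onesFrom-round r x i = begin
    onesFrom (round r x) i                                       ≡⟨ +-identityʳ _ ⟨
    onesFrom (round r x) i + 0                                   ≡⟨ cong (onesFrom (round r x) i +_) (crossing-beyond r x _ (m≤n+m∸n N i)) ⟨
    onesFrom (round r x) i + crossing r x (i + (N ∸ i))          ≡⟨ ones-round r x (N ∸ i) i ⟩
    onesFrom x i + crossing r x i                                ∎
    where open ≡-Reasoning

  onesFrom-split : ∀ x i → i < N → onesFrom x i ≡ bit (x i) + onesFrom x (suc i)
  onesFrom-split x i i<N rewrite +-∸-assoc 1 i<N = refl

  onesFrom-beyond : ∀ x i → N ≤ i → onesFrom x i ≡ 0
  onesFrom-beyond x i N≤i rewrite m≤n⇒m∸n≡0 N≤i = refl

  ones≤length : ∀ x i l → ones x i l ≤ l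
  ones≤length x i zero = z≤n
  ones≤length x i (suc l) = +-mono-≤ (bit≤1 (x i)) (ones≤length x (suc i) l)

  onesFrom≤ : ∀ x i → onesFrom x i ≤ N ∸ i
  onesFrom≤ x i = ones≤length x i (N ∸ i)

  onesFrom-suc≤ : ∀ x i → onesFrom x (suc i) ≤ onesFrom x i
  onesFrom-suc≤ x i with suc i ≤? N
  ... | yes i<N = subst (onesFrom x (suc i) ≤_) (sym (onesFrom-split x i i<N)) (m≤n+m _ _)
  ... | no i≮N = subst (_≤ onesFrom x i) (sym (onesFrom-beyond x (suc i) (<⇒≤ (≰⇒> i≮N)))) z≤n

  onesFrom-antitone : ∀ x {i j} → i ≤ j → onesFrom x j ≤ onesFrom x i
  onesFrom-antitone x {i} i≤j with m≤n⇒∃[o]m+o≡n i≤j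
  ... | d , refl = go d
    where
    go : ∀ d → onesFrom x (i + d) ≤ onesFrom x i
    go zero rewrite +-identityʳ i = ≤-refl
    go (suc d) rewrite +-suc i d = ≤-trans (onesFrom-suc≤ x (i + d)) (go d)

  doubleRound : Line → Line
  doubleRound x = round true (round false x)

  doubleRounds : ℕ → Line → Line
  doubleRounds zero x = x
  doubleRounds (suc t) x = doubleRound (doubleRounds t x)

  total-doubleRound : ∀ x → onesFrom (doubleRound x) 0 ≡ onesFrom x 0
  total-doubleRound x = begin
    onesFrom (doubleRound x) 0   ≡⟨ onesFrom-round true (round false x) 0 ⟩
    onesFrom (round false x) 0 + 0 ≡⟨ trans (+-identityʳ _) (onesFrom-round false x 0) ⟩
    onesFrom x 0 + 0             ≡⟨ +-identityʳ _ ⟩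
    onesFrom x 0                 ∎
    where open ≡-Reasoning

  total-doubleRounds : ∀ t x → onesFrom (doubleRounds t x) 0 ≡ onesFrom x 0
  total-doubleRounds zero x = refl
  total-doubleRounds (suc t) x = trans (total-doubleRound (doubleRounds t x)) (total-doubleRounds t x)

  onesFrom-round-mono : ∀ r x i → onesFrom x i ≤ onesFrom (round r x) i
  onesFrom-round-mono r x i = subst (onesFrom x i ≤_) (sym (onesFrom-round r x i)) (m≤m+n _ _)

  onesFrom-doubleRound-mono : ∀ x i → onesFrom x i ≤ onesFrom (doubleRound x) i
  onesFrom-doubleRound-mono x i =
    ≤-trans (onesFrom-round-mono false x i) (onesFrom-round-mono true (round false x) i)

  onesFrom-doubleRounds-mono : ∀ d t x i → onesFrom (doubleRounds t x) i ≤ onesFrom (doubleRounds (d + t) x) i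
  onesFrom-doubleRounds-mono zero t x i = ≤-refl
  onesFrom-doubleRounds-mono (suc d) t x i =
    ≤-trans (onesFrom-doubleRounds-mono d t x i) (onesFrom-doubleRound-mono (doubleRounds (d + t) x) i)

  round-keeps-one : ∀ r x i → lowerEnd r i ≡ false → x i ≡ true → round r x i ≡ true
  round-keeps-one r x i h xᵢ with lowerEnd r i | upperEnd r i
  round-keeps-one r x i refl xᵢ | false | true rewrite xᵢ = ∨-zeroʳ (x (pred i))
  round-keeps-one r x i refl xᵢ | false | false = xᵢ

  round-keeps-zero : ∀ r x i → upperEnd r i ≡ false → x i ≡ false → round r x i ≡ false
  round-keeps-zero r x i h xᵢ with lowerEnd r i | upperEnd r i
  round-keeps-zero r x i refl xᵢ | true | false rewrite xᵢ = refl
  round-keeps-zero r x i refl xᵢ | false | false = xᵢ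

  -- the comparator (p, p + 1) acts in one of the two rounds and lifts the one above p
  onesFrom-descent : ∀ x p → x p ≡ true → x (suc p) ≡ false → suc p < N →
                     suc (onesFrom x (suc p)) ≤ onesFrom (doubleRound x) (suc p)
  onesFrom-descent x p xₚ xₚ₊₁ p+1<N with odd p in oddₚ
  ... | false = begin
      suc (onesFrom x (suc p))                        ≡⟨ +-comm 1 _ ⟩
      onesFrom x (suc p) + 1                          ≤⟨ +-monoʳ-≤ _ lifted ⟩
      onesFrom x (suc p) + crossing false x (suc p)   ≡⟨ onesFrom-round false x (suc p) ⟨
      onesFrom (round false x) (suc p)                ≤⟨ onesFrom-round-mono true _ (suc p) ⟩
      onesFrom (doubleRound x) (suc p)                ∎
    where
    open ≤-Reasoning
    acts : lowerEnd false p ≡ true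
    acts rewrite oddₚ = T⇒≡true (<⇒<ᵇ p+1<N)
    lifted : 1 ≤ crossing false x (suc p)
    lifted rewrite acts | xₚ | xₚ₊₁ = ≤-refl
  ... | true = begin
      suc (onesFrom x (suc p))                        ≡⟨ +-comm 1 _ ⟩
      onesFrom x (suc p) + 1                          ≤⟨ +-mono-≤ (onesFrom-round-mono false x (suc p)) lifted ⟩
      onesFrom y (suc p) + crossing true y (suc p)    ≡⟨ onesFrom-round true y (suc p) ⟨
      onesFrom (doubleRound x) (suc p)                ∎
    where
    open ≤-Reasoning
    y = round false x
    idle : lowerEnd false p ≡ false
    idle rewrite oddₚ = refl
    acts : lowerEnd true p ≡ true
    acts rewrite oddₚ = T⇒≡true (<⇒<ᵇ p+1<N)
    lifted : 1 ≤ crossing true y (suc p)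
    lifted rewrite acts | round-keeps-one false x p idle xₚ | round-keeps-zero false x (suc p) idle xₚ₊₁ = ≤-refl

  private
    one-if-full : ∀ b s j → suc j ≤ bit b + s → s ≤ j → b ≡ true
    one-if-full true s j _ _ = refl
    one-if-full false s j j<s s≤j = contradiction j<s (≤⇒≯ s≤j)

    zero-if-short : ∀ b s j → bit b + s ≤ j → j ≤ s → b ≡ false
    zero-if-short false s j _ _ = refl
    zero-if-short true s j s<j j≤s = contradiction s<j (≤⇒≯ j≤s)

    rest-of-full : ∀ b s j → suc j ≤ bit b + s → j ≤ s
    rest-of-full true s j (s≤s j≤s) = j≤s
    rest-of-full false s j j<s = ≤-trans (n≤1+n j) j<s

  one-zero-at : ∀ x p j → suc p < N → suc j ≤ onesFrom x p → onesFrom x (suc p) ≤ j →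
                j ≤ onesFrom x (suc (suc p)) → x p ≡ true × x (suc p) ≡ false
  one-zero-at x p j p+1<N above short rest =
    one-if-full (x p) _ j (subst (suc j ≤_) (onesFrom-split x p (<-trans (n<1+n p) p+1<N)) above) short ,
    zero-if-short (x (suc p)) _ j (subst (_≤ j) (onesFrom-split x (suc p) p+1<N) short) rest

  module Progress (x₀ : Line) where

    K : ℕ
    K = onesFrom x₀ 0

    progress : ∀ t i j → i + j + j ≡ t → suc j ≤ K → i + suc j ≤ N →
               suc j ≤ onesFrom (doubleRounds t x₀) i
    progress t zero j _ j<K _ = subst (suc j ≤_) (sym (total-doubleRounds t x₀)) j<K
    progress (suc t) (suc p) j eq j<K p+j+2≤N with suc j ≤? onesFrom (doubleRounds t x₀) (suc p)
    ... | yes already = ≤-trans already (onesFrom-doubleRound-mono _ (suc p))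
    ... | no notYet = ≤-trans (s≤s (rest-of-full (x p) _ j (subst (suc j ≤_) (onesFrom-split x p p<N) atP)))
                              (onesFrom-descent x p xₚ xₚ₊₁ p+1<N)
      where
      x = doubleRounds t x₀
      p+1<N : suc p < N
      p+1<N = ≤-trans (s≤s (s≤s (m≤m+n p j))) (subst (_≤ N) (cong suc (+-suc p j)) p+j+2≤N)
      p<N : p < N
      p<N = <-trans (n<1+n p) p+1<N
      atP : suc j ≤ onesFrom x p
      atP = progress t p j (suc-injective eq) j<K (≤-trans (n≤1+n _) p+j+2≤N)
      short : onesFrom x (suc p) ≤ j
      short = ≤-pred (≰⇒> notYet)
      rest : j ≤ onesFrom x (suc (suc p))
      rest = above j refl
        where
        above : ∀ j′ → j′ ≡ j → j′ ≤ onesFrom x (suc (suc p))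
        above zero _ = z≤n
        above (suc j′) e = progress t (suc (suc p)) j′ time j′<K bound
          where
          time : suc (suc p) + j′ + j′ ≡ t
          time = trans (shift p j′) (subst (λ z → p + z + z ≡ t) (sym e) (suc-injective eq))
            where
            shift : ∀ p j′ → suc (suc p) + j′ + j′ ≡ p + suc j′ + suc j′
            shift = solve-∀
          j′<K : suc j′ ≤ K
          j′<K = ≤-trans (n≤1+n _) (subst (λ z → suc z ≤ K) (sym e) j<K)
          bound : suc (suc p) + suc j′ ≤ N
          bound = subst (_≤ N) (cong suc (+-suc p (suc j′))) (subst (λ z → suc p + suc z ≤ N) (sym e) p+j+2≤N)
      xₚ = proj₁ (one-zero-at x p j p+1<N atP short rest)
      xₚ₊₁ = proj₂ (one-zero-at x p j p+1<N atP short rest)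

    K≤N : K ≤ N
    K≤N = onesFrom≤ x₀ 0

    sorted : Line
    sorted = doubleRounds (N + N) x₀

    progress-sorted : ∀ i j → suc j ≤ K → i + suc j ≤ N → suc j ≤ onesFrom sorted i
    progress-sorted i j j<K bound =
      subst (λ t → suc j ≤ onesFrom (doubleRounds t x₀) i) (m∸n+n≡m time≤)
            (≤-trans (progress _ i j refl j<K bound) (onesFrom-doubleRounds-mono (N + N ∸ (i + j + j)) (i + j + j) x₀ i))
      where
      i+j≤N : i + j ≤ N
      i+j≤N = ≤-trans (+-monoʳ-≤ i (n≤1+n j)) bound
      time≤ : i + j + j ≤ N + N
      time≤ = +-mono-≤ i+j≤N (≤-trans (m≤n+m j i) i+j≤N)

    sorted-top : K ≤ onesFrom sorted (N ∸ K)
    sorted-top = fill K refl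
      where
      fill : ∀ k → k ≡ K → k ≤ onesFrom sorted (N ∸ K)
      fill zero _ = z≤n
      fill (suc k) e = progress-sorted (N ∸ K) k (≤-reflexive e)
                                       (≤-reflexive (trans (cong (N ∸ K +_) e) (m∸n+n≡m K≤N)))

    sorted-one : ∀ i → i < N → N ∸ K ≤ i → sorted i ≡ true
    sorted-one i i<N N∸K≤i =
      one-if-full (sorted i) _ d (subst (suc d ≤_) (onesFrom-split sorted i i<N) full) (onesFrom≤ sorted (suc i))
      where
      d = N ∸ suc i
      N∸i≡1+d : N ∸ i ≡ suc d
      N∸i≡1+d = +-∸-assoc 1 i<N
      full : suc d ≤ onesFrom sorted i
      full = progress-sorted i d
        (subst (_≤ K) N∸i≡1+d (subst (N ∸ i ≤_) (m∸[m∸n]≡n K≤N) (∸-monoʳ-≤ N N∸K≤i)))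
        (≤-reflexive (trans (cong (i +_) (sym N∸i≡1+d)) (m+[n∸m]≡n (<⇒≤ i<N))))

    sorted-zero : ∀ i → i < N → i < N ∸ K → sorted i ≡ false
    sorted-zero i i<N i<N∸K = zero-if-short (sorted i) _ K
      (subst (_≤ K) (onesFrom-split sorted i i<N)
             (subst (onesFrom sorted i ≤_) (total-doubleRounds (N + N) x₀) (onesFrom-antitone sorted {0} {i} z≤n)))
      (≤-trans sorted-top (onesFrom-antitone sorted i<N∸K))

    sorted-is-step : ∀ i → i < N → sorted i ≡ (N ∸ K ≤ᵇ i)
    sorted-is-step i i<N with N ∸ K ≤? i
    ... | yes N∸K≤i = trans (sorted-one i i<N N∸K≤i) (sym (T⇒≡true (≤⇒≤ᵇ N∸K≤i)))
    ... | no N∸K≰i = trans (sorted-zero i i<N (≰⇒> N∸K≰i)) (sym (dec-false (N ∸ K ≤? i) N∸K≰i))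

-- Counting ranks above a threshold

module RankCounting (N : ℕ) (τ : ℕ → ℕ)
  (τ-bounded : ∀ j → j < N → τ j < N)
  (τ-injective : ∀ j j′ → j < N → j′ < N → τ j ≡ τ j′ → j ≡ j′)
  (τ-surjective : ∀ k → k < N → ∃ λ j → j < N × τ j ≡ k) where

  atLeast : ℕ → ℕ
  atLeast k = sumRange (λ j → bit (k ≤ᵇ τ j)) 0 N

  exactly : ℕ → ℕ
  exactly k = sumRange (λ j → bit (τ j ℕ.≡ᵇ k)) 0 N

  private
    bit-≤ᵇ-split : ∀ k t → bit (k ≤ᵇ t) ≡ bit (suc k ≤ᵇ t) + bit (t ℕ.≡ᵇ k)
    bit-≤ᵇ-split zero zero = refl
    bit-≤ᵇ-split zero (suc t) = refl
    bit-≤ᵇ-split (suc k) zero = refl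
    bit-≤ᵇ-split (suc k) (suc t) = shifted k t
      where
      shifted : ∀ k t → bit (suc k ≤ᵇ suc t) ≡ bit (suc (suc k) ≤ᵇ suc t) + bit (t ℕ.≡ᵇ k)
      shifted zero zero = refl
      shifted zero (suc t) = refl
      shifted (suc k) zero = refl
      shifted (suc k) (suc t) = shifted k t

  atLeast-suc : ∀ k → atLeast k ≡ atLeast (suc k) + exactly k
  atLeast-suc k = trans (sumRange-cong _ _ 0 N (λ j _ _ → bit-≤ᵇ-split k (τ j))) (sumRange-+ _ _ 0 N)

  exactly-one : ∀ k → k < N → exactly k ≡ 1
  exactly-one k k<N with τ-surjective k k<N
  ... | j₀ , j₀<N , τj₀≡k = sumRange-single _ 0 N j₀ z≤n j₀<N
          (cong bit (dec-true (τ j₀ ℕ.≟ k) τj₀≡k))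
          (λ j _ j<N j≢j₀ → cong bit (dec-false (τ j ℕ.≟ k) λ τj≡k →
                                        j≢j₀ (τ-injective j j₀ j<N j₀<N (trans τj≡k (sym τj₀≡k)))))

  atLeast-beyond : ∀ k → N ≤ k → atLeast k ≡ 0
  atLeast-beyond k N≤k = sumRange-zero _ 0 N
    (λ j _ j<N → cong bit (dec-false (k ≤? τ j) (<⇒≱ (<-≤-trans (τ-bounded j j<N) N≤k))))

  atLeast-below : ∀ d → d ≤ N → atLeast (N ∸ d) ≡ d
  atLeast-below zero _ = atLeast-beyond N ≤-refl
  atLeast-below (suc d) d<N = begin
    atLeast (N ∸ suc d)                              ≡⟨ atLeast-suc (N ∸ suc d) ⟩
    atLeast (suc (N ∸ suc d)) + exactly (N ∸ suc d)  ≡⟨ cong (λ k → atLeast k + exactly (N ∸ suc d)) (+-∸-assoc 1 d<N) ⟨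
    atLeast (N ∸ d) + exactly (N ∸ suc d)            ≡⟨ cong₂ _+_ (atLeast-below d (<⇒≤ d<N)) (exactly-one _ below) ⟩
    d + 1                                            ≡⟨ +-comm d 1 ⟩
    suc d                                            ∎
    where
    open ≡-Reasoning
    below : N ∸ suc d < N
    below = subst (_≤ N) (+-∸-assoc 1 d<N) (m∸n≤m N d)

  atLeast-value : ∀ k → atLeast k ≡ N ∸ k
  atLeast-value k with k ≤? N
  ... | yes k≤N = trans (cong atLeast (sym (m∸[m∸n]≡n k≤N))) (atLeast-below (N ∸ k) (m∸n≤m N k))
  ... | no k≰N = trans (atLeast-beyond k (<⇒≤ (≰⇒> k≰N))) (sym (m≤n⇒m∸n≡0 (<⇒≤ (≰⇒> k≰N))))

-- Boolean runs of networks

swapEdge compareEdge : Fin m → Fin m → MEdge m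
swapEdge u v = medge u v false
compareEdge u v = medge u v true

Off : MEdge m → Fin m → Set
Off e w = w ≢ src e × w ≢ tgt e

EdgesDisjoint : MEdge m → MEdge m → Set
EdgesDisjoint e f = Off f (src e) × Off f (tgt e)

StagesDisjoint : Stage m → Stage m → Set
StagesDisjoint s t = All (λ e → All (EdgesDisjoint e) t) s

private
  if-no : ∀ {A : Set} {a b : Fin m} → a ≢ b → (x y : A) → (if does (a ≟ b) then x else y) ≡ y
  if-no {a = a} {b} a≢b x y = cong (if_then x else y) (dec-false (a ≟ b) a≢b)

  ≡-or-≢ : (a b : Fin m) → a ≡ b ⊎ a ≢ b
  ≡-or-≢ a b with a ≟ b
  ... | yes a≡b = inj₁ a≡b
  ... | no a≢b = inj₂ a≢b

  if-yes : ∀ {A : Set} (a : Fin m) → (x y : A) → (if does (a ≟ a) then x else y) ≡ x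
  if-yes a x y = cong (if_then x else y) (dec-true (a ≟ a) refl)

applyEdgeᵇ-cong : {c d : BoolConfig m} → c ≗ d → ∀ e → applyEdgeᵇ c e ≗ applyEdgeᵇ d e
applyEdgeᵇ-cong c≗d (medge u v true) w rewrite c≗d u | c≗d v | c≗d w = refl
applyEdgeᵇ-cong c≗d (medge u v false) w rewrite c≗d u | c≗d v | c≗d w = refl

applyStageᵇ-cong : {c d : BoolConfig m} → c ≗ d → ∀ s → applyStageᵇ c s ≗ applyStageᵇ d s
applyStageᵇ-cong c≗d [] = c≗d
applyStageᵇ-cong c≗d (e ∷ s) = applyStageᵇ-cong (applyEdgeᵇ-cong c≗d e) s

runᵇ-cong : {c d : BoolConfig m} → c ≗ d → ∀ M → runᵇ M c ≗ runᵇ M d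
runᵇ-cong c≗d [] = c≗d
runᵇ-cong c≗d (s ∷ M) = runᵇ-cong (applyStageᵇ-cong c≗d s) M

applyStageᵇ-++ : ∀ (c : BoolConfig m) s t → applyStageᵇ c (s ++ t) ≡ applyStageᵇ (applyStageᵇ c s) t
applyStageᵇ-++ = foldl-++ applyEdgeᵇ

runᵇ-++ : ∀ (M M′ : List (Stage m)) c → runᵇ (M ++ M′) c ≡ runᵇ M′ (runᵇ M c)
runᵇ-++ M M′ c = foldl-++ applyStageᵇ c M M′

applyEdgeᵇ-local : ∀ (c d : BoolConfig m) e w → c (src e) ≡ d (src e) → c (tgt e) ≡ d (tgt e) →
                   c w ≡ d w → applyEdgeᵇ c e w ≡ applyEdgeᵇ d e w
applyEdgeᵇ-local c d (medge u v true) w cu≡ cv≡ cw≡ rewrite cu≡ | cv≡ | cw≡ = refl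
applyEdgeᵇ-local c d (medge u v false) w cu≡ cv≡ cw≡ rewrite cu≡ | cv≡ | cw≡ = refl

applyEdgeᵇ-off : ∀ (c : BoolConfig m) e {w} → Off e w → applyEdgeᵇ c e w ≡ c w
applyEdgeᵇ-off c (medge u v true) {w} (w≢u , w≢v) rewrite if-no w≢u (c u ∧ c v) (if does (w ≟ v) then c u ∨ c v else c w) = if-no w≢v _ _
applyEdgeᵇ-off c (medge u v false) {w} (w≢u , w≢v) rewrite if-no w≢u (c v) (if does (w ≟ v) then c u else c w) = if-no w≢v _ _

EdgesDisjoint-sym : {e f : MEdge m} → EdgesDisjoint e f → EdgesDisjoint f e
EdgesDisjoint-sym ((se≢sf , se≢tf) , (te≢sf , te≢tf)) =
  (≢-sym se≢sf , ≢-sym te≢sf) , (≢-sym se≢tf , ≢-sym te≢tf)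

private
  commute-off : ∀ (c : BoolConfig m) e f {w} → EdgesDisjoint e f → Off f w →
                applyEdgeᵇ (applyEdgeᵇ c e) f w ≡ applyEdgeᵇ (applyEdgeᵇ c f) e w
  commute-off c e f (se-off , te-off) w-off =
    trans (applyEdgeᵇ-off _ f w-off)
          (applyEdgeᵇ-local c _ e _ (sym (applyEdgeᵇ-off c f se-off)) (sym (applyEdgeᵇ-off c f te-off))
                                    (sym (applyEdgeᵇ-off c f w-off)))

applyEdgeᵇ-comm : ∀ (c : BoolConfig m) e f → EdgesDisjoint e f →
                  applyEdgeᵇ (applyEdgeᵇ c e) f ≗ applyEdgeᵇ (applyEdgeᵇ c f) e
applyEdgeᵇ-comm c e f e∥f w with ≡-or-≢ w (src f) | ≡-or-≢ w (tgt f)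
... | inj₂ w≢sf | inj₂ w≢tf = commute-off c e f e∥f (w≢sf , w≢tf)
... | inj₁ refl | _ = sym (commute-off c f e f∥e (proj₁ f∥e))
  where f∥e = EdgesDisjoint-sym {e = e} {f} e∥f
... | inj₂ _ | inj₁ refl = sym (commute-off c f e f∥e (proj₂ f∥e))
  where f∥e = EdgesDisjoint-sym {e = e} {f} e∥f

applyStageᵇ-comm-edge : ∀ (c : BoolConfig m) e t → All (EdgesDisjoint e) t →
                        applyStageᵇ (applyEdgeᵇ c e) t ≗ applyEdgeᵇ (applyStageᵇ c t) e
applyStageᵇ-comm-edge c e [] _ _ = refl
applyStageᵇ-comm-edge c e (f ∷ t) (e∥f ∷ e∥t) w =
  trans (applyStageᵇ-cong (applyEdgeᵇ-comm c e f e∥f) t w) (applyStageᵇ-comm-edge (applyEdgeᵇ c f) e t e∥t w)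

applyStageᵇ-comm : ∀ (c : BoolConfig m) s t → StagesDisjoint s t →
                   applyStageᵇ (applyStageᵇ c s) t ≗ applyStageᵇ (applyStageᵇ c t) s
applyStageᵇ-comm c [] t _ _ = refl
applyStageᵇ-comm c (e ∷ s) t (e∥t ∷ s∥t) w =
  trans (applyStageᵇ-comm (applyEdgeᵇ c e) s t s∥t w) (applyStageᵇ-cong (applyStageᵇ-comm-edge c e t e∥t) s w)

runᵇ-comm-stage : ∀ (c : BoolConfig m) t As → All (λ s → StagesDisjoint s t) As →
                  runᵇ As (applyStageᵇ c t) ≗ applyStageᵇ (runᵇ As c) t
runᵇ-comm-stage c t [] _ _ = refl
runᵇ-comm-stage c t (s ∷ As) (s∥t ∷ As∥t) w =
  trans (runᵇ-cong (λ w′ → sym (applyStageᵇ-comm c s t s∥t w′)) As w) (runᵇ-comm-stage (applyStageᵇ c s) t As As∥t w)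

Interleavable : List (Stage m) → List (Stage m) → Set
Interleavable As Bs = All (λ t → All (λ s → StagesDisjoint s t) As) Bs

runᵇ-zipWith-++ : ∀ (c : BoolConfig m) As Bs → Interleavable As Bs → length As ≡ length Bs →
                  runᵇ (zipWith _++_ As Bs) c ≗ runᵇ Bs (runᵇ As c)
runᵇ-zipWith-++ c [] [] _ _ _ = refl
runᵇ-zipWith-++ c (s ∷ As) (t ∷ Bs) ((_ ∷ As∥t) ∷ rest) |As|≡|Bs| w = begin
  runᵇ (zipWith _++_ As Bs) (applyStageᵇ c (s ++ t)) w
    ≡⟨ cong (λ d → runᵇ (zipWith _++_ As Bs) d w) (applyStageᵇ-++ c s t) ⟩
  runᵇ (zipWith _++_ As Bs) (applyStageᵇ (applyStageᵇ c s) t) w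
    ≡⟨ runᵇ-zipWith-++ _ As Bs (All.map tail rest) (suc-injective |As|≡|Bs|) w ⟩
  runᵇ Bs (runᵇ As (applyStageᵇ (applyStageᵇ c s) t)) w
    ≡⟨ runᵇ-cong (runᵇ-comm-stage (applyStageᵇ c s) t As As∥t) Bs w ⟩
  runᵇ Bs (applyStageᵇ (runᵇ As (applyStageᵇ c s)) t) w ∎
  where
  open ≡-Reasoning
  tail : ∀ {t′} → All (λ s′ → StagesDisjoint s′ t′) (s ∷ As) → All (λ s′ → StagesDisjoint s′ t′) As
  tail (_ ∷ p) = p

EdgesWithin : (Fin m → Set) → Stage m → Set
EdgesWithin U s = All (λ e → U (src e) × U (tgt e)) s

EdgesWithin-mono : ∀ {U W : Fin m → Set} → (∀ {x} → U x → W x) → ∀ {s} → EdgesWithin U s → EdgesWithin W s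
EdgesWithin-mono U⊆W = All.map λ (us , ut) → U⊆W us , U⊆W ut

zipWith-++-within : ∀ {U : Fin m → Set} {As Bs} → All (EdgesWithin U) As → All (EdgesWithin U) Bs →
                    All (EdgesWithin U) (zipWith _++_ As Bs)
zipWith-++-within [] _ = []
zipWith-++-within (_ ∷ _) [] = []
zipWith-++-within (inS ∷ inAs) (inT ∷ inBs) = AllP.++⁺ inS inT ∷ zipWith-++-within inAs inBs

endpoints-within : ∀ {V : Fin m → Set} s → EdgesWithin V s → ∀ {x} → x ∈ endpoints s → V x
endpoints-within (e ∷ s) ((vs , _) ∷ _) (here refl) = vs
endpoints-within (e ∷ s) ((_ , vt) ∷ _) (there (here refl)) = vt
endpoints-within (e ∷ s) (_ ∷ rest) (there (there x∈)) = endpoints-within s rest x∈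

module _ {U W : Fin m → Set} (apart : ∀ {x} → U x → W x → ⊥) where

  private
    ≢-across : ∀ {x y} → U x → W y → x ≢ y
    ≢-across ux wy refl = apart ux wy

  within-apart⇒interleavable : ∀ {As Bs} → All (EdgesWithin U) As → All (EdgesWithin W) Bs → Interleavable As Bs
  within-apart⇒interleavable inAs = All.map λ inT → All.map (λ inS → All.map (λ (us , ut) →
    All.map (λ (ws , wt) → (≢-across us ws , ≢-across us wt) , (≢-across ut ws , ≢-across ut wt)) inT) inS) inAs

  zipWith-++-matchings : ∀ {H : Graph m} {As Bs} → All (IsDirectedMatching H) As → All (IsDirectedMatching H) Bs →
                         All (EdgesWithin U) As → All (EdgesWithin W) Bs → All (IsDirectedMatching H) (zipWith _++_ As Bs)
  zipWith-++-matchings [] _ _ _ = []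
  zipWith-++-matchings (_ ∷ _) [] _ _ = []
  zipWith-++-matchings {H} {s ∷ _} {t ∷ _} ((es , s!) ∷ ms) ((et , t!) ∷ mt) (inS ∷ inAs) (inT ∷ inBs) =
    (AllP.++⁺ es et , subst Unique (sym (concatMap-++ _ s t))
                           (Unique.++⁺ s! t! λ (x∈s , x∈t) → apart (endpoints-within s inS x∈s) (endpoints-within t inT x∈t)))
    ∷ zipWith-++-matchings {H} ms mt inAs inBs

runᵇ-concatMap-identity : ∀ {A : Set} (g : A → List (Stage m)) → (∀ x c → runᵇ (g x) c ≗ c) →
                          ∀ xs c → runᵇ (concatMap g xs) c ≗ c
runᵇ-concatMap-identity g id-g [] c _ = refl
runᵇ-concatMap-identity g id-g (x ∷ xs) c w =
  trans (cong (λ d → d w) (runᵇ-++ (g x) (concatMap g xs) c))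
        (trans (runᵇ-concatMap-identity g id-g xs _ w) (id-g x c w))

swap-at-src : ∀ (c : BoolConfig m) u v → applyEdgeᵇ c (swapEdge u v) u ≡ c v
swap-at-src c u v = if-yes u (c v) _

swap-at-tgt : ∀ (c : BoolConfig m) u v → u ≢ v → applyEdgeᵇ c (swapEdge u v) v ≡ c u
swap-at-tgt c u v u≢v rewrite if-no (≢-sym u≢v) (c v) (if does (v ≟ v) then c u else c v) = if-yes v (c u) (c v)

compare-at-src : ∀ (c : BoolConfig m) u v → applyEdgeᵇ c (compareEdge u v) u ≡ c u ∧ c v
compare-at-src c u v = if-yes u (c u ∧ c v) _

compare-at-tgt : ∀ (c : BoolConfig m) u v → u ≢ v → applyEdgeᵇ c (compareEdge u v) v ≡ c u ∨ c v
compare-at-tgt c u v u≢v rewrite if-no (≢-sym u≢v) (c u ∧ c v) (if does (v ≟ v) then c u ∨ c v else c v) = if-yes v (c u ∨ c v) (c v)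

swap-twice : ∀ (c : BoolConfig m) u v → applyEdgeᵇ (applyEdgeᵇ c (swapEdge u v)) (swapEdge u v) ≗ c
swap-twice c u v w with w ≟ u
swap-twice c u v .u | yes refl with u ≟ v
... | yes refl = swap-at-src c u u
... | no u≢v = swap-at-tgt c u v u≢v
swap-twice c u v w | no w≢u with w ≟ v
swap-twice c u v .v | no v≢u | yes refl = swap-at-src c u v
swap-twice c u v w | no w≢u | no w≢v = refl

module _ (c : BoolConfig m) {u v b : Fin m} (u≢v : u ≢ v) (u≢b : u ≢ b) (v≢b : v ≢ b) where

  private
    c₁ c₂ c₃ : BoolConfig m
    c₁ = applyEdgeᵇ c (swapEdge u v)
    c₂ = applyEdgeᵇ c₁ (compareEdge v b)
    c₃ = applyEdgeᵇ c₂ (swapEdge u v)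

    b-fixed : c₁ b ≡ c b
    b-fixed = applyEdgeᵇ-off c (swapEdge u v) (≢-sym u≢b , ≢-sym v≢b)

    conjugate-at-u : c₃ u ≡ applyEdgeᵇ c (compareEdge u b) u
    conjugate-at-u = begin
      c₃ u          ≡⟨ swap-at-src c₂ u v ⟩
      c₂ v          ≡⟨ compare-at-src c₁ v b ⟩
      c₁ v ∧ c₁ b   ≡⟨ cong₂ _∧_ (swap-at-tgt c u v u≢v) b-fixed ⟩
      c u ∧ c b     ≡⟨ compare-at-src c u b ⟨
      applyEdgeᵇ c (compareEdge u b) u ∎
      where open ≡-Reasoning

    conjugate-at-v : c₃ v ≡ applyEdgeᵇ c (compareEdge u b) v
    conjugate-at-v = begin
      c₃ v          ≡⟨ swap-at-tgt c₂ u v u≢v ⟩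
      c₂ u          ≡⟨ applyEdgeᵇ-off c₁ (compareEdge v b) (u≢v , u≢b) ⟩
      c₁ u          ≡⟨ swap-at-src c u v ⟩
      c v           ≡⟨ applyEdgeᵇ-off c (compareEdge u b) (≢-sym u≢v , v≢b) ⟨
      applyEdgeᵇ c (compareEdge u b) v ∎
      where open ≡-Reasoning

    conjugate-at-b : c₃ b ≡ applyEdgeᵇ c (compareEdge u b) b
    conjugate-at-b = begin
      c₃ b          ≡⟨ applyEdgeᵇ-off c₂ (swapEdge u v) (≢-sym u≢b , ≢-sym v≢b) ⟩
      c₂ b          ≡⟨ compare-at-tgt c₁ v b v≢b ⟩
      c₁ v ∨ c₁ b   ≡⟨ cong₂ _∨_ (swap-at-tgt c u v u≢v) b-fixed ⟩
      c u ∨ c b     ≡⟨ compare-at-tgt c u b u≢b ⟨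
      applyEdgeᵇ c (compareEdge u b) b ∎
      where open ≡-Reasoning

  -- a comparator (v, b) conjugated by the swap (u, v) acts as the comparator (u, b)
  compare-conjugate : c₃ ≗ applyEdgeᵇ c (compareEdge u b)
  compare-conjugate w with ≡-or-≢ w u | ≡-or-≢ w v | ≡-or-≢ w b
  ... | inj₁ refl | _ | _ = conjugate-at-u
  ... | inj₂ _ | inj₁ refl | _ = conjugate-at-v
  ... | inj₂ _ | inj₂ _ | inj₁ refl = conjugate-at-b
  ... | inj₂ w≢u | inj₂ w≢v | inj₂ w≢b =
    trans (applyEdgeᵇ-off c₂ (swapEdge u v) (w≢u , w≢v))
          (trans (applyEdgeᵇ-off c₁ (compareEdge v b) (w≢v , w≢b))
                 (trans (applyEdgeᵇ-off c (swapEdge u v) (w≢u , w≢v))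
                        (sym (applyEdgeᵇ-off c (compareEdge u b) (w≢u , w≢b)))))

-- A breadth-first tree, its depth-first tour, and the network

module TourNetwork {n : ℕ} (G : Graph (suc n)) (conn : Connected G) where

  N : ℕ
  N = suc n

  V : Set
  V = Fin N

  root : V
  root = Fin.zero

  opaque
    reach : ℕ → V → Bool
    reach zero v = does (v ≟ root)
    reach (suc d) v = reach d v ∨ does (any? λ u → reach d u ∧ adj G u v ≟ᵇ true)

    reach-step : ∀ d {u v} → reach d u ≡ true → E G u v → reach (suc d) v ≡ true
    reach-step d {u} {v} du uv =
      trans (cong (reach d v ∨_) (dec-true (any? λ w → reach d w ∧ adj G w v ≟ᵇ true) (u , cong₂ _∧_ du uv)))
            (∨-zeroʳ (reach d v))

    reach-mono : ∀ {d d′ v} → d ≤ d′ → reach d v ≡ true → reach d′ v ≡ true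
    reach-mono d≤d′ = go (≤⇒≤′ d≤d′)
      where
      go : ∀ {d d′ v} → d ≤′ d′ → reach d v ≡ true → reach d′ v ≡ true
      go ≤′-refl dv = dv
      go {v = v} (≤′-step d≤d′) dv rewrite go {v = v} d≤d′ dv = refl

    reach-new : ∀ d v → reach (suc d) v ≡ true → reach d v ≡ false → ∃ λ u → reach d u ∧ adj G u v ≡ true
    reach-new d v new notYet rewrite notYet =
      from-does (any? λ u → reach d u ∧ adj G u v ≟ᵇ true) new

    reachable : ∀ v → ∃ λ d → reach d v ≡ true
    reachable v = walk 0 (conn root v) refl
      where
      walk : ∀ d {u w} → Reach G u w → reach d u ≡ true → ∃ λ d′ → reach d′ w ≡ true
      walk d here du = d , du
      walk d (step uv vw) du = walk (suc d) vw (reach-step d du uv)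

    level : V → ℕ
    level v = least (λ d → reach d v) (proj₁ (reachable v))

    reach-level : ∀ v → reach (level v) v ≡ true
    reach-level v = least-holds (λ d → reach d v) (proj₁ (reachable v)) (proj₂ (reachable v))

    level-≤ : ∀ v d → reach d v ≡ true → level v ≤ d
    level-≤ v d dv = least-≤ (λ d → reach d v) (proj₁ (reachable v)) d dv

    <level⇒unreached : ∀ {d} v → d < level v → reach d v ≡ false
    <level⇒unreached {d} v d<level = <least⇒false (λ d → reach d v) (proj₁ (reachable v)) d d<level

    level-root : level root ≡ 0
    level-root = n≤0⇒n≡0 (level-≤ root 0 refl)

    level≡0⇒root : ∀ v → level v ≡ 0 → v ≡ root
    level≡0⇒root v level≡0 = from-does (v ≟ root) (subst (λ d → reach d v ≡ true) level≡0 (reach-level v))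

    private
      pick : {P : V → Set} → Dec (∃ P) → V
      pick (yes (u , _)) = u
      pick (no _) = root

      pick-holds : {P : V → Set} (P? : Dec (∃ P)) → ∃ P → P (pick P?)
      pick-holds (yes (_ , Pu)) _ = Pu
      pick-holds (no ∄P) ∃P = contradiction ∃P ∄P

    parent : V → V
    parent v = pick (any? λ u → reach (pred (level v)) u ∧ adj G u v ≟ᵇ true)

    private
      parent-candidate : ∀ v {d} → level v ≡ suc d → reach d (parent v) ∧ adj G (parent v) v ≡ true
      parent-candidate v {d} level≡ =
        subst (λ l → reach (pred l) (parent v) ∧ adj G (parent v) v ≡ true) level≡
          (pick-holds (any? λ u → reach (pred (level v)) u ∧ adj G u v ≟ᵇ true)
            (subst (λ l → ∃ λ u → reach (pred l) u ∧ adj G u v ≡ true) (sym level≡)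
              (reach-new d v (subst (λ l → reach l v ≡ true) level≡ (reach-level v))
                             (<level⇒unreached v (subst (d <_) (sym level≡) ≤-refl)))))

    parent-adjacent : ∀ v {d} → level v ≡ suc d → E G (parent v) v
    parent-adjacent v {d} level≡ = proj₂ (∧-true (reach d (parent v)) (parent-candidate v level≡))

    reach-parent : ∀ v {d} → level v ≡ suc d → reach d (parent v) ≡ true
    reach-parent v {d} level≡ = proj₁ (∧-true (reach d (parent v)) (parent-candidate v level≡))

    level-parent : ∀ v {d} → level v ≡ suc d → level (parent v) ≡ d
    level-parent v {d} level≡ with level (parent v) <? d
    ... | no ≮d = ≤-antisym (level-≤ (parent v) d (reach-parent v level≡)) (≮⇒≥ ≮d)
    ... | yes <d with trans (sym (reach-mono <d (reach-step (level (parent v)) (reach-level (parent v)) (parent-adjacent v level≡))))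
                             (<level⇒unreached v (subst (d <_) (sym level≡) ≤-refl))
    ...   | ()

  Child : V → V → Set
  Child v c = level c ≡ suc (level v) × parent c ≡ v

  child? : ∀ v c → Dec (Child v c)
  child? v c = (level c ℕ.≟ suc (level v)) ×-dec (parent c ≟ v)

  child-adjacent : ∀ {v c} → Child v c → E G v c
  child-adjacent {c = c} (level≡ , refl) = parent-adjacent c level≡

  child-adjacent′ : ∀ {v c} → Child v c → E G c v
  child-adjacent′ {v} {c} ch = trans (Graph.sym G c v) (child-adjacent ch)

  children : V → List V
  children v = filter (child? v) (allFin N)

  ∈-children⁺ : ∀ {v c} → Child v c → c ∈ children v
  ∈-children⁺ {v} {c} = ∈-filter⁺ (child? v) (∈-allFin c)

  ∈-children⁻ : ∀ {v c} → c ∈ children v → Child v c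
  ∈-children⁻ {v} c∈ = proj₂ (∈-filter⁻ (child? v) c∈)

  children-unique : ∀ v → Unique (children v)
  children-unique v = Unique.filter⁺ (child? v) (Unique.allFin⁺ N)

  ancestor : ℕ → V → V
  ancestor zero x = x
  ancestor (suc a) x = parent (ancestor a x)

  Ancestor : V → V → Set
  Ancestor v x = ∃ λ a → ancestor a x ≡ v × level x ≡ a + level v

  Ancestor-refl : ∀ v → Ancestor v v
  Ancestor-refl v = 0 , refl , refl

  Ancestor-child : ∀ {v c x} → Child v c → Ancestor c x → Ancestor v x
  Ancestor-child {v} (level≡ , parent≡) (a , above , level-x) =
    suc a , trans (cong parent above) parent≡ , trans level-x (trans (cong (a +_) level≡) (+-suc a (level v)))

  Ancestor-level : ∀ {v x} → Ancestor v x → level v ≤ level x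
  Ancestor-level {v} (a , _ , level-x) = subst (level v ≤_) (sym level-x) (m≤n+m (level v) a)

  Ancestor-unique : ∀ {v v′ x} → Ancestor v x → Ancestor v′ x → level v ≡ level v′ → v ≡ v′
  Ancestor-unique {x = x} (a , refl , level-x) (a′ , refl , level-x′) level≡ =
    cong (λ b → ancestor b x) (+-cancelʳ-≡ _ a a′ (trans (sym level-x) (trans level-x′ (cong (a′ +_) (sym level≡)))))

  level-ancestor : ∀ a x → a ≤ level x → level (ancestor a x) + a ≡ level x
  level-ancestor zero x _ = +-identityʳ (level x)
  level-ancestor (suc a) x a<level = from (level (ancestor a x)) refl
    where
    IH = level-ancestor a x (<⇒≤ a<level)
    from : ∀ l → level (ancestor a x) ≡ l → level (ancestor (suc a) x) + suc a ≡ level x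
    from zero level≡ = contradiction (trans (sym IH) (cong (_+ a) level≡)) (>⇒≢ a<level)
    from (suc d) level≡ = trans (cong (_+ suc a) (level-parent (ancestor a x) level≡))
                                (trans (+-suc d a) (trans (cong (_+ a) (sym level≡)) IH))

  Ancestor-via-child : ∀ {v x} a → ancestor (suc a) x ≡ v → level x ≡ suc a + level v →
                       Child v (ancestor a x) × Ancestor (ancestor a x) x
  Ancestor-via-child {v} {x} a above level-x =
    (level-u , above) , a , refl , trans level-x (trans (sym (+-suc a (level v))) (cong (a +_) (sym level-u)))
    where
    level-u : level (ancestor a x) ≡ suc (level v)
    level-u = +-cancelʳ-≡ a _ _ (trans (level-ancestor a x (subst (a ≤_) (sym level-x) (≤-trans (n≤1+n a) (m≤m+n _ _))))
                                       (trans level-x (cong suc (+-comm a (level v)))))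

  Ancestor-root : ∀ x → Ancestor root x
  Ancestor-root x =
    level x ,
    level≡0⇒root _ (+-cancelʳ-≡ (level x) _ 0 (level-ancestor (level x) x ≤-refl)) ,
    trans (sym (+-identityʳ (level x))) (cong (level x +_) (sym level-root))

  height : ℕ
  height = foldr _⊔_ 0 (map level (allFin N))

  level≤height : ∀ v → level v ≤ height
  level≤height v = ≤-maximum level (∈-allFin v)

  -- f is fuel: it suffices once it exceeds the height of the subtree of v
  mutual
    tourFrom : ℕ → V → List V
    tourFrom zero v = []
    tourFrom (suc f) v = v ∷ concatMap (tourTo f) (children v)

    tourTo : ℕ → V → List V
    tourTo zero v = []
    tourTo (suc f) v = concatMap (tourFrom f) (children v) ++ v ∷ []

  private
    ∈-concatMap-children⁻ : ∀ (g : V → List V) {v x} → x ∈ concatMap g (children v) → ∃ λ c → Child v c × x ∈ g c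
    ∈-concatMap-children⁻ g x∈ with find (∈-concatMap⁻ g x∈)
    ... | c , c∈ , x∈gc = c , ∈-children⁻ c∈ , x∈gc

    ∈-concatMap-children⁺ : ∀ (g : V → List V) {v c x} → Child v c → x ∈ g c → x ∈ concatMap g (children v)
    ∈-concatMap-children⁺ g ch x∈gc = ∈-concatMap⁺ g (lose (∈-children⁺ ch) x∈gc)

  mutual
    tourFrom-sound : ∀ f v {x} → x ∈ tourFrom f v → Ancestor v x
    tourFrom-sound (suc f) v (here refl) = Ancestor-refl v
    tourFrom-sound (suc f) v (there x∈) with ∈-concatMap-children⁻ (tourTo f) x∈
    ... | c , ch , x∈c = Ancestor-child ch (tourTo-sound f c x∈c)

    tourTo-sound : ∀ f v {x} → x ∈ tourTo f v → Ancestor v x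
    tourTo-sound (suc f) v x∈ with ∈-++⁻ (concatMap (tourFrom f) (children v)) x∈
    ... | inj₂ (here refl) = Ancestor-refl v
    ... | inj₁ x∈′ with ∈-concatMap-children⁻ (tourFrom f) x∈′
    ...   | c , ch , x∈c = Ancestor-child ch (tourFrom-sound f c x∈c)

  private
    fuel-exhausted : ∀ {v x} → Ancestor v x → level x < level v + 0 → ⊥
    fuel-exhausted {v} {x} an x<v+0 = <⇒≱ (subst (level x <_) (+-identityʳ (level v)) x<v+0) (Ancestor-level an)

    fuel-for-child : ∀ {v c x} f → Child v c → level x < level v + suc f → level x < level c + f
    fuel-for-child {v} {x = x} f (level≡ , _) = subst (level x <_) (trans (+-suc (level v) f) (cong (_+ f) (sym level≡)))

  mutual
    tourFrom-complete : ∀ f v {x} → Ancestor v x → level x < level v + f → x ∈ tourFrom f v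
    tourFrom-complete zero v an x< = contradiction x< (fuel-exhausted an)
    tourFrom-complete (suc f) v (zero , refl , _) _ = here refl
    tourFrom-complete (suc f) v (suc a , above , level-x) x< with Ancestor-via-child a above level-x
    ... | ch , an = there (∈-concatMap-children⁺ (tourTo f) ch (tourTo-complete f _ an (fuel-for-child f ch x<)))

    tourTo-complete : ∀ f v {x} → Ancestor v x → level x < level v + f → x ∈ tourTo f v
    tourTo-complete zero v an x< = contradiction x< (fuel-exhausted an)
    tourTo-complete (suc f) v (zero , refl , _) _ = ∈-++⁺ʳ (concatMap (tourFrom f) (children v)) (here refl)
    tourTo-complete (suc f) v (suc a , above , level-x) x< with Ancestor-via-child a above level-x
    ... | ch , an = ∈-++⁺ˡ (∈-concatMap-children⁺ (tourFrom f) ch (tourFrom-complete f _ an (fuel-for-child f ch x<)))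

  private
    subtrees-disjoint : ∀ {g : V → List V} → (∀ {c x} → x ∈ g c → Ancestor c x) →
                        ∀ {v c c′} → c ∈ children v → c′ ∈ children v → c ≢ c′ → Disjoint (g c) (g c′)
    subtrees-disjoint sound {c = c} {c′} c∈ c′∈ c≢c′ (x∈ , x∈′) =
      c≢c′ (Ancestor-unique (sound x∈) (sound x∈′)
                            (trans (proj₁ (∈-children⁻ c∈)) (sym (proj₁ (∈-children⁻ c′∈)))))

    not-in-subtrees : ∀ {g : V → List V} → (∀ {c x} → x ∈ g c → Ancestor c x) →
                      ∀ {v} → v ∈ concatMap g (children v) → ⊥
    not-in-subtrees {g} sound v∈ with ∈-concatMap-children⁻ g v∈
    ... | c , (level≡ , _) , v∈c = 1+n≰n (subst (_≤ _) level≡ (Ancestor-level (sound v∈c)))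

    all-children : ∀ {P : V → Set} v → (∀ {c} → Child v c → P c) → All P (children v)
    all-children v h = All.tabulate (h ∘ ∈-children⁻)

  mutual
    tourFrom-unique : ∀ f v → Unique (tourFrom f v)
    tourFrom-unique zero v = []
    tourFrom-unique (suc f) v =
      All.tabulate (λ x∈ v≡x → not-in-subtrees (tourTo-sound f _) (subst (_∈ _) (sym v≡x) x∈)) ∷
      concatMap-unique (tourTo f) (children-unique v) (all-children v (λ {c} _ → tourTo-unique f c))
                       (subtrees-disjoint (tourTo-sound f _))

    tourTo-unique : ∀ f v → Unique (tourTo f v)
    tourTo-unique zero v = []
    tourTo-unique (suc f) v =
      Unique.++⁺ (concatMap-unique (tourFrom f) (children-unique v) (all-children v (λ {c} _ → tourFrom-unique f c))
                                   (subtrees-disjoint (tourFrom-sound f _)))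
                 ([] ∷ [])
                 (λ { (v∈ , here refl) → not-in-subtrees (tourFrom-sound f _) v∈ })

  tour : List V
  tour = tourFrom (suc height) root

  ∈-tour : ∀ x → x ∈ tour
  ∈-tour x = tourFrom-complete (suc height) root (Ancestor-root x)
    (subst (level x <_) (cong (_+ suc height) (sym level-root)) (s≤s (level≤height x)))

  tour-unique : Unique tour
  tour-unique = tourFrom-unique (suc height) root

  length-tour : length tour ≡ N
  length-tour = trans (↭-length (∼bag⇒↭ (unique∧set⇒bag tour-unique (Unique.allFin⁺ N)
                                          (mk⇔ (λ _ → ∈-allFin _) (λ _ → ∈-tour _)))))
                      (length-tabulate (λ (v : V) → v))

  data Route : Set where
    route₁ : V → V → Route
    route₂ : V → V → V → Route
    route₃ : V → V → V → V → Route

  start end : Route → V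
  start (route₁ a b) = a
  start (route₂ a x b) = a
  start (route₃ a x y b) = a
  end (route₁ a b) = b
  end (route₂ a x b) = b
  end (route₃ a x y b) = b

  vertices : Route → List V
  vertices (route₁ a b) = a ∷ b ∷ []
  vertices (route₂ a x b) = a ∷ x ∷ b ∷ []
  vertices (route₃ a x y b) = a ∷ x ∷ y ∷ b ∷ []

  ValidRoute : Route → Set
  ValidRoute (route₁ a b) = E G a b × a ≢ b
  ValidRoute (route₂ a x b) = E G a x × E G x b × a ≢ x × x ≢ b × a ≢ b
  ValidRoute (route₃ a x y b) = E G a x × E G x y × E G y b × a ≢ x × a ≢ b × x ≢ y × x ≢ b × y ≢ b

  firstChildOrSelf lastChildOrSelf : V → V
  firstChildOrSelf v = headOr v (children v)
    where
    headOr : V → List V → V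
    headOr d [] = d
    headOr d (x ∷ _) = x
  lastChildOrSelf v = lastOr v (children v)

  data Kind : Set where
    entering stepping returning : Kind

  -- the end of a link is determined by its kind, its center and its key
  Target : Kind → V → V → V → Set
  Target entering v k b = b ≡ firstChildOrSelf k
  Target stepping v k b = b ≡ k
  Target returning v k b = b ≡ v

  Near : V → V → Set
  Near v x = Σ (Ancestor v x) λ an → proj₁ an ≤ 2

  record Link (a b : V) : Set where
    field
      route : Route
      starts : start route ≡ a
      ends : end route ≡ b
      valid : ValidRoute route
      center key : V
      kind : Kind
      key-child : Child center key
      near-center : All (Near center) (vertices route)
      target : Target kind center key b

  private
    lastOr-∈ : ∀ (x : V) xs → lastOr x xs ∈ x ∷ xs
    lastOr-∈ x [] = here refl
    lastOr-∈ x (y ∷ xs) = there (lastOr-∈ y xs)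

  firstChildOrSelf-cases : ∀ c → firstChildOrSelf c ≡ c ⊎ Child c (firstChildOrSelf c)
  firstChildOrSelf-cases c with children c in eq
  ... | [] = inj₁ refl
  ... | x ∷ _ = inj₂ (∈-children⁻ (subst (x ∈_) (sym eq) (here refl)))

  lastChildOrSelf-cases : ∀ c → lastChildOrSelf c ≡ c ⊎ Child c (lastChildOrSelf c)
  lastChildOrSelf-cases c with children c in eq
  ... | [] = inj₁ refl
  ... | x ∷ xs = inj₂ (∈-children⁻ (subst (lastOr x xs ∈_) (sym eq) (lastOr-∈ x xs)))

  near-self : ∀ v → Near v v
  near-self v = Ancestor-refl v , z≤n

  near-child : ∀ {v c} → Child v c → Near v c
  near-child ch = Ancestor-child ch (Ancestor-refl _) , s≤s z≤n

  near-grandchild : ∀ {v c g} → Child v c → Child c g → Near v g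
  near-grandchild ch ch′ = Ancestor-child ch (Ancestor-child ch′ (Ancestor-refl _)) , s≤s (s≤s z≤n)

  private
    level-≢ : ∀ {a b} → level a ≢ level b → a ≢ b
    level-≢ ≢ refl = ≢ refl

    parent-≢ : ∀ {v c} → Child v c → v ≢ c
    parent-≢ (level≡ , _) = level-≢ (λ e → <⇒≢ (n<1+n _) (trans e level≡))

    grandparent-≢ : ∀ {v c g} → Child v c → Child c g → v ≢ g
    grandparent-≢ (level≡ , _) (level≡′ , _) =
      level-≢ (λ e → <⇒≢ (s≤s (n≤1+n _)) (trans e (trans level≡′ (cong suc level≡))))

    uncle-≢ : ∀ {v c c′ g} → Child v c → Child v c′ → Child c′ g → c ≢ g
    uncle-≢ (level≡ , _) (level≡′ , _) (level≡″ , _) =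
      level-≢ (λ e → <⇒≢ (n<1+n _) (trans (sym level≡) (trans e (trans level≡″ (cong suc level≡′)))))

  link-down : ∀ {v c} → Child v c → Link v (firstChildOrSelf c)
  link-down {v} {c} ch with firstChildOrSelf-cases c
  ... | inj₁ first≡c = record
    { route = route₁ v c ; starts = refl ; ends = sym first≡c
    ; valid = child-adjacent ch , parent-≢ ch
    ; center = v ; key = c ; kind = entering ; key-child = ch
    ; near-center = near-self v ∷ near-child ch ∷ [] ; target = refl }
  ... | inj₂ ch′ = record
    { route = route₂ v c (firstChildOrSelf c) ; starts = refl ; ends = refl
    ; valid = child-adjacent ch , child-adjacent ch′ , parent-≢ ch , parent-≢ ch′ , grandparent-≢ ch ch′
    ; center = v ; key = c ; kind = entering ; key-child = ch
    ; near-center = near-self v ∷ near-child ch ∷ near-grandchild ch ch′ ∷ [] ; target = refl }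

  link-across-down : ∀ {v c c′} → Child v c → Child v c′ → c ≢ c′ → Link c (firstChildOrSelf c′)
  link-across-down {v} {c} {c′} ch ch₁ c≢c′ with firstChildOrSelf-cases c′
  ... | inj₁ first≡c′ = record
    { route = route₂ c v c′ ; starts = refl ; ends = sym first≡c′
    ; valid = child-adjacent′ ch , child-adjacent ch₁ , ≢-sym (parent-≢ ch) , parent-≢ ch₁ , c≢c′
    ; center = v ; key = c′ ; kind = entering ; key-child = ch₁
    ; near-center = near-child ch ∷ near-self v ∷ near-child ch₁ ∷ [] ; target = refl }
  ... | inj₂ ch′ = record
    { route = route₃ c v c′ (firstChildOrSelf c′) ; starts = refl ; ends = refl
    ; valid = child-adjacent′ ch , child-adjacent ch₁ , child-adjacent ch′ , ≢-sym (parent-≢ ch) , uncle-≢ ch ch₁ ch′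
            , parent-≢ ch₁ , grandparent-≢ ch₁ ch′ , parent-≢ ch′
    ; center = v ; key = c′ ; kind = entering ; key-child = ch₁
    ; near-center = near-child ch ∷ near-self v ∷ near-child ch₁ ∷ near-grandchild ch₁ ch′ ∷ [] ; target = refl }

  link-across-up : ∀ {v c c′} → Child v c → Child v c′ → c ≢ c′ → Link (lastChildOrSelf c) c′
  link-across-up {v} {c} {c′} ch ch₁ c≢c′ with lastChildOrSelf-cases c
  ... | inj₁ last≡c = record
    { route = route₂ c v c′ ; starts = sym last≡c ; ends = refl
    ; valid = child-adjacent′ ch , child-adjacent ch₁ , ≢-sym (parent-≢ ch) , parent-≢ ch₁ , c≢c′
    ; center = v ; key = c′ ; kind = stepping ; key-child = ch₁
    ; near-center = near-child ch ∷ near-self v ∷ near-child ch₁ ∷ [] ; target = refl }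
  ... | inj₂ ch′ = record
    { route = route₃ (lastChildOrSelf c) c v c′ ; starts = refl ; ends = refl
    ; valid = child-adjacent′ ch′ , child-adjacent′ ch , child-adjacent ch₁ , ≢-sym (parent-≢ ch′)
            , ≢-sym (uncle-≢ ch₁ ch ch′) , ≢-sym (parent-≢ ch) , c≢c′ , parent-≢ ch₁
    ; center = v ; key = c′ ; kind = stepping ; key-child = ch₁
    ; near-center = near-grandchild ch ch′ ∷ near-child ch ∷ near-self v ∷ near-child ch₁ ∷ [] ; target = refl }

  link-up : ∀ {v c} → Child v c → Link (lastChildOrSelf c) v
  link-up {v} {c} ch with lastChildOrSelf-cases c
  ... | inj₁ last≡c = record
    { route = route₁ c v ; starts = sym last≡c ; ends = refl
    ; valid = child-adjacent′ ch , ≢-sym (parent-≢ ch)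
    ; center = v ; key = c ; kind = returning ; key-child = ch
    ; near-center = near-child ch ∷ near-self v ∷ [] ; target = refl }
  ... | inj₂ ch′ = record
    { route = route₂ (lastChildOrSelf c) c v ; starts = refl ; ends = refl
    ; valid = child-adjacent′ ch′ , child-adjacent′ ch , ≢-sym (parent-≢ ch′) , ≢-sym (parent-≢ ch)
            , ≢-sym (grandparent-≢ ch ch′)
    ; center = v ; key = c ; kind = returning ; key-child = ch
    ; near-center = near-grandchild ch ch′ ∷ near-child ch ∷ near-self v ∷ [] ; target = refl }

  data Path (R : V → V → Set) : V → V → List V → Set where
    stop : ∀ {a} → Path R a a (a ∷ [])
    _▸_ : ∀ {a b c xs} → R a b → Path R b c xs → Path R a c (a ∷ xs)

  infixr 5 _▸_

  Path-++ : ∀ {R a b c d xs ys} → Path R a b xs → R b c → Path R c d ys → Path R a d (xs ++ ys)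
  Path-++ stop r q = r ▸ q
  Path-++ (r′ ▸ p) r q = r′ ▸ Path-++ p r q

  Path⇒Linked : ∀ {R a b xs} → Path R a b xs → Linked R xs
  Path⇒Linked stop = [-]
  Path⇒Linked (r ▸ stop) = r ∷ [-]
  Path⇒Linked (r ▸ p@(_ ▸ _)) = r ∷ Path⇒Linked p

  concatMap-Path : ∀ {R : V → V → Set} {P : V → Set} (g : V → List V) (first last : V → V) →
                   (∀ {x} → P x → Path R (first x) (last x) (g x)) →
                   (∀ {x y} → P x → P y → x ≢ y → R (last x) (first y)) →
                   ∀ {c cs} → All P (c ∷ cs) → Linked _≢_ (c ∷ cs) →
                   Path R (first c) (last (lastOr c cs)) (concatMap g (c ∷ cs))
  concatMap-Path {R} g first last path connect {c} {[]} (Pc ∷ []) _ =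
    subst (Path R (first c) (last c)) (sym (++-identityʳ (g c))) (path Pc)
  concatMap-Path g first last path connect {c} {c′ ∷ cs} (Pc ∷ Pcs@(Pc′ ∷ _)) (c≢c′ ∷ distinct) =
    Path-++ (path Pc) (connect Pc Pc′ c≢c′) (concatMap-Path g first last path connect Pcs distinct)

  FuelFor : ℕ → V → Set
  FuelFor f v = height < level v + suc f

  private
    fuel-child : ∀ {f v c} → FuelFor (suc f) v → Child v c → FuelFor f c
    fuel-child {f} {v} fuel (level≡ , _) = subst (height <_) (trans (+-suc (level v) (suc f)) (cong (_+ suc f) (sym level≡))) fuel

    childless-without-fuel : ∀ {v c} → FuelFor 0 v → Child v c → ⊥
    childless-without-fuel {v} {c} fuel (level≡ , _) =
      <⇒≱ fuel (≤-trans (≤-reflexive (trans (+-comm (level v) 1) (sym level≡))) (level≤height c))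

    children-distinct : ∀ v → Linked _≢_ (children v)
    children-distinct v = AllPairs⇒Linked (children-unique v)

  mutual
    pathFrom : ∀ f v → FuelFor f v → Path Link v (lastChildOrSelf v) (tourFrom (suc f) v)
    pathFrom f v fuel = along f (children v) refl fuel
      where
      along : ∀ f cs → children v ≡ cs → FuelFor f v → Path Link v (lastChildOrSelf v) (tourFrom (suc f) v)
      along f [] eq _ rewrite eq = stop
      along zero (c ∷ _) eq fuel = ⊥-elim (childless-without-fuel fuel (∈-children⁻ (subst (c ∈_) (sym eq) (here refl))))
      along (suc f) (c ∷ cs) eq fuel rewrite eq =
        link-down (children-of-v (here refl)) ▸
        concatMap-Path (tourTo (suc f)) firstChildOrSelf (λ x → x)
          (λ ch → pathTo f _ (fuel-child fuel ch)) link-across-down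
          (All.tabulate children-of-v) (subst (Linked _≢_) eq (children-distinct v))
        where
        children-of-v : ∀ {x} → x ∈ c ∷ cs → Child v x
        children-of-v x∈ = ∈-children⁻ (subst (_ ∈_) (sym eq) x∈)

    pathTo : ∀ f v → FuelFor f v → Path Link (firstChildOrSelf v) v (tourTo (suc f) v)
    pathTo f v fuel = along f (children v) refl fuel
      where
      along : ∀ f cs → children v ≡ cs → FuelFor f v → Path Link (firstChildOrSelf v) v (tourTo (suc f) v)
      along f [] eq _ rewrite eq = stop
      along zero (c ∷ _) eq fuel = ⊥-elim (childless-without-fuel fuel (∈-children⁻ (subst (c ∈_) (sym eq) (here refl))))
      along (suc f) (c ∷ cs) eq fuel rewrite eq =
        Path-++ (concatMap-Path (tourFrom (suc f)) (λ x → x) lastChildOrSelf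
                   (λ ch → pathFrom f _ (fuel-child fuel ch)) link-across-up
                   (All.tabulate children-of-v) (subst (Linked _≢_) eq (children-distinct v)))
                (link-up (children-of-v (lastOr-∈ c cs)))
                stop
        where
        children-of-v : ∀ {x} → x ∈ c ∷ cs → Child v x
        children-of-v x∈ = ∈-children⁻ (subst (_ ∈_) (sym eq) x∈)

  tour-linked : Linked Link tour
  tour-linked = Path⇒Linked (pathFrom height root (subst (λ l → height < l + suc height) (sym level-root) ≤-refl))

  -- Colouring the links

  Δ : ℕ
  Δ = maxDegree G

  degree≤Δ : ∀ v → degree G v ≤ Δ
  degree≤Δ v = ≤-maximum (degree G) (∈-allFin v)

  EarlierSibling : V → V → Set
  EarlierSibling c k = Child (parent c) k × toℕ k < toℕ c

  earlierSibling? : ∀ c k → Dec (EarlierSibling c k)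
  earlierSibling? c k = child? (parent c) k ×-dec (toℕ k <? toℕ c)

  rank : V → ℕ
  rank c = length (filter (earlierSibling? c) (allFin N))

  private
    not-earlier-than-self : ∀ c → ¬ EarlierSibling c c
    not-earlier-than-self c (_ , c<c) = <-irrefl refl c<c

  rank-< : ∀ {v c c′} → Child v c → Child v c′ → toℕ c < toℕ c′ → rank c < rank c′
  rank-< {v} {c} {c′} ch@(_ , parent≡) ch′@(_ , parent≡′) c<c′ =
    length-filter-< (earlierSibling? c) (earlierSibling? c′) later (∈-allFin c)
                    (subst (λ p → Child p c) (sym parent≡′) ch , c<c′) (not-earlier-than-self c)
    where
    later : ∀ {k} → EarlierSibling c k → EarlierSibling c′ k
    later {k} (sib , k<c) = subst (λ p → Child p k) (trans parent≡ (sym parent≡′)) sib , <-trans k<c c<c′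

  rank-injective : ∀ {v c c′} → Child v c → Child v c′ → rank c ≡ rank c′ → c ≡ c′
  rank-injective ch ch′ rank≡ with <-cmp (toℕ _) (toℕ _)
  ... | tri< c<c′ _ _ = contradiction rank≡ (<⇒≢ (rank-< ch ch′ c<c′))
  ... | tri≈ _ c≡c′ _ = toℕ-injective c≡c′
  ... | tri> _ _ c′<c = contradiction (sym rank≡) (<⇒≢ (rank-< ch′ ch c′<c))

  rank<Δ : ∀ {v c} → Child v c → rank c < Δ
  rank<Δ {v} {c} ch@(_ , parent≡) = begin-strict
    rank c                                    <⟨ length-filter-< (earlierSibling? c) (child? v) sibling (∈-allFin c) ch (not-earlier-than-self c) ⟩
    length (filter (child? v) (allFin N))     ≤⟨ length-filter≤sum (child? v) (adj G v) child-adjacent (allFin N) ⟩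
    degree G v                                ≤⟨ degree≤Δ v ⟩
    Δ                                         ∎
    where
    open ≤-Reasoning
    sibling : ∀ {k} → EarlierSibling c k → Child v k
    sibling {k} (sib , _) = subst (λ p → Child p k) parent≡ sib

  kindCode : Kind → ℕ
  kindCode entering = 0
  kindCode stepping = 1
  kindCode returning = 2

  kindCode<3 : ∀ t → kindCode t < 3
  kindCode<3 entering = s≤s z≤n
  kindCode<3 stepping = s≤s (s≤s z≤n)
  kindCode<3 returning = s≤s (s≤s (s≤s z≤n))

  kindCode-injective : ∀ t t′ → kindCode t ≡ kindCode t′ → t ≡ t′
  kindCode-injective entering entering _ = refl
  kindCode-injective stepping stepping _ = refl
  kindCode-injective returning returning _ = refl

  colour : ∀ {a b} → Link a b → ℕ
  colour ℓ = mod3 (level (Link.center ℓ)) + 3 * (kindCode (Link.kind ℓ) + 3 * rank (Link.key ℓ))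

  colours : ℕ
  colours = 9 * Δ

  colour<colours : ∀ {a b} (ℓ : Link a b) → colour ℓ < colours
  colour<colours ℓ = base3-bound (mod3<3 (level (Link.center ℓ))) (kindCode<3 (Link.kind ℓ)) (rank<Δ (Link.key-child ℓ))

  private
    Target-functional : ∀ t v k {b b′} → Target t v k b → Target t v k b′ → b ≡ b′
    Target-functional entering v k b≡ b′≡ = trans b≡ (sym b′≡)
    Target-functional stepping v k b≡ b′≡ = trans b≡ (sym b′≡)
    Target-functional returning v k b≡ b′≡ = trans b≡ (sym b′≡)

  -- a shared vertex pins down the center (levels mod 3), then key and kind (colour), hence the target
  same-colour-same-target : ∀ {a b a′ b′} (ℓ : Link a b) (ℓ′ : Link a′ b′) → colour ℓ ≡ colour ℓ′ →
                            ∀ {x} → x ∈ vertices (Link.route ℓ) → x ∈ vertices (Link.route ℓ′) → b ≡ b′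
  same-colour-same-target ℓ ℓ′ colour≡ x∈ x∈′ =
    Target-functional (kind ℓ) (center ℓ) (key ℓ) (target ℓ)
      (subst (λ t → Target t (center ℓ) (key ℓ) _) (sym kind≡)
        (subst₂ (λ v k → Target (kind ℓ′) v k _) (sym center≡) (sym key≡) (target ℓ′)))
    where
    open Link
    digits = base3-injective (mod3<3 (level (center ℓ))) (kindCode<3 (kind ℓ)) (mod3<3 (level (center ℓ′))) (kindCode<3 (kind ℓ′)) colour≡
    near = All.lookup (near-center ℓ) x∈
    near′ = All.lookup (near-center ℓ′) x∈′
    height≡ : proj₁ (proj₁ near) ≡ proj₁ (proj₁ near′)
    height≡ = mod3-cancel (proj₂ near) (proj₂ near′)
                          (trans (sym (proj₂ (proj₂ (proj₁ near)))) (proj₂ (proj₂ (proj₁ near′)))) (proj₁ digits)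
    center≡ : center ℓ ≡ center ℓ′
    center≡ = Ancestor-unique (proj₁ near) (proj₁ near′)
      (+-cancelˡ-≡ _ _ _ (trans (sym (proj₂ (proj₂ (proj₁ near))))
                               (trans (proj₂ (proj₂ (proj₁ near′))) (cong (_+ level (center ℓ′)) (sym height≡)))))
    key≡ : key ℓ ≡ key ℓ′
    key≡ = rank-injective (key-child ℓ) (subst (λ v → Child v (key ℓ′)) (sym center≡) (key-child ℓ′))
                          (proj₂ (proj₂ digits))
    kind≡ : kind ℓ ≡ kind ℓ′
    kind≡ = kindCode-injective _ _ (proj₁ (proj₂ digits))

  opaque
    at : ℕ → V
    at = nthOr root tour

    private
      <N⇒<length : ∀ {i} → i < N → i < length tour
      <N⇒<length {i} = subst (i <_) (sym length-tour)

    at-injective : ∀ {i j} → i < N → j < N → at i ≡ at j → i ≡ j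
    at-injective i<N j<N = nthOr-injective root tour-unique (<N⇒<length i<N) (<N⇒<length j<N)

    at-≢ : ∀ {i j} → i < N → j < N → i ≢ j → at i ≢ at j
    at-≢ i<N j<N i≢j = i≢j ∘ at-injective i<N j<N

    position : ∀ v → ∃ λ i → i < N × at i ≡ v
    position v with ∈⇒nthOr root (∈-tour v)
    ... | i , i< , at≡ = i , subst (i <_) length-tour i< , at≡

    linkAt : ∀ i → suc i < N → Link (at i) (at (suc i))
    linkAt i i+1<N = nthOr-Linked root tour-linked (<N⇒<length i+1<N)

  -- outside the tour routeAt and colourAt are junk, never used
  routeAt : ℕ → Route
  routeAt i with suc i <? N
  ... | yes i+1<N = Link.route (linkAt i i+1<N)
  ... | no _ = route₁ root root

  colourAt : ℕ → ℕ
  colourAt i with suc i <? N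
  ... | yes i+1<N = colour (linkAt i i+1<N)
  ... | no _ = 0

  routeAt-linkAt : ∀ i (i+1<N : suc i < N) → routeAt i ≡ Link.route (linkAt i i+1<N)
  routeAt-linkAt i i+1<N with suc i <? N
  ... | yes p = cong (λ q → Link.route (linkAt i q)) (≤-irrelevant p i+1<N)
  ... | no ≮ = contradiction i+1<N ≮

  colourAt-linkAt : ∀ i (i+1<N : suc i < N) → colourAt i ≡ colour (linkAt i i+1<N)
  colourAt-linkAt i i+1<N with suc i <? N
  ... | yes p = cong (λ q → colour (linkAt i q)) (≤-irrelevant p i+1<N)
  ... | no ≮ = contradiction i+1<N ≮

  routeAt-valid : ∀ i → suc i < N → ValidRoute (routeAt i)
  routeAt-valid i i+1<N = subst ValidRoute (sym (routeAt-linkAt i i+1<N)) (Link.valid (linkAt i i+1<N))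

  comparatorAt : ℕ → MEdge N
  comparatorAt i = compareEdge (at i) (at (suc i))

  routeAt-ends : ∀ i → suc i < N → compareEdge (start (routeAt i)) (end (routeAt i)) ≡ comparatorAt i
  routeAt-ends i i+1<N rewrite routeAt-linkAt i i+1<N =
    cong₂ compareEdge (Link.starts (linkAt i i+1<N)) (Link.ends (linkAt i i+1<N))

  RoutesDisjoint : ℕ → ℕ → Set
  RoutesDisjoint i j = Disjoint (vertices (routeAt i)) (vertices (routeAt j))

  routes-disjoint : ∀ {i j} → suc i < N → suc j < N → i ≢ j → colourAt i ≡ colourAt j → RoutesDisjoint i j
  routes-disjoint {i} {j} i+1<N j+1<N i≢j colour≡ (x∈ , x∈′)
    rewrite routeAt-linkAt i i+1<N | routeAt-linkAt j j+1<N =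
    i≢j (suc-injective (at-injective i+1<N j+1<N
      (same-colour-same-target (linkAt i i+1<N) (linkAt j j+1<N)
        (trans (sym (colourAt-linkAt i i+1<N)) (trans colour≡ (colourAt-linkAt j j+1<N))) x∈ x∈′)))

  routeStages : Route → List (Stage N)
  routeStages (route₁ a b) = (compareEdge a b ∷ []) ∷ [] ∷ [] ∷ [] ∷ [] ∷ []
  routeStages (route₂ a x b) = (swapEdge a x ∷ []) ∷ (compareEdge x b ∷ []) ∷ (swapEdge a x ∷ []) ∷ [] ∷ [] ∷ []
  routeStages (route₃ a x y b) =
    (swapEdge a x ∷ []) ∷ (swapEdge x y ∷ []) ∷ (compareEdge y b ∷ []) ∷ (swapEdge x y ∷ []) ∷ (swapEdge a x ∷ []) ∷ []

  runᵇ-routeStages : ∀ R → ValidRoute R → ∀ c → runᵇ (routeStages R) c ≗ applyEdgeᵇ c (compareEdge (start R) (end R))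
  runᵇ-routeStages (route₁ a b) _ c _ = refl
  runᵇ-routeStages (route₂ a x b) (_ , _ , a≢x , x≢b , a≢b) c = compare-conjugate c a≢x a≢b x≢b
  runᵇ-routeStages (route₃ a x y b) (_ , _ , _ , a≢x , a≢b , x≢y , x≢b , y≢b) c w =
    trans (applyEdgeᵇ-cong (compare-conjugate (applyEdgeᵇ c (swapEdge a x)) x≢y x≢b y≢b) (swapEdge a x) w)
          (compare-conjugate c a≢x a≢b x≢b w)

  length-routeStages : ∀ R → length (routeStages R) ≡ 5
  length-routeStages (route₁ _ _) = refl
  length-routeStages (route₂ _ _ _) = refl
  length-routeStages (route₃ _ _ _ _) = refl

  -- Simulating the transposition sort along the tour

  open OddEvenTranspositionSort N using (Line; lowerEnd; upperEnd; round; lowerEnd-suc; lowerEnd-bounded; doubleRounds)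

  applyComparators : List ℕ → BoolConfig N → BoolConfig N
  applyComparators js c = applyStageᵇ c (map comparatorAt js)

  module ComparatorsOfRound (r : Bool) where

    Lower : ℕ → Set
    Lower i = lowerEnd r i ≡ true

    private
      lower-apart : ∀ {i j} → Lower i → Lower j → suc i ≢ j
      lower-apart {i} lᵢ lⱼ refl with trans (sym lⱼ) (lowerEnd-suc r i lᵢ)
      ... | ()

      lower<N : ∀ {j} → Lower j → j < N
      lower<N {j} lⱼ = <-trans (n<1+n j) (lowerEnd-bounded r j lⱼ)

      ∉⇒≢ : ∀ {i : ℕ} {js} → All (i ≢_) js → ∀ {j} → j ∈ js → j ≢ i
      ∉⇒≢ i∉ j∈ j≡i = All.lookup i∉ j∈ (sym j≡i)

      untouched : ∀ c {i j} → Lower j → i < N → i ≢ j → i ≢ suc j → applyEdgeᵇ c (comparatorAt j) (at i) ≡ c (at i)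
      untouched c {i} {j} lⱼ i<N i≢j i≢j+1 =
        applyEdgeᵇ-off c (comparatorAt j) (at-≢ i<N (lower<N lⱼ) i≢j , at-≢ i<N (lowerEnd-bounded r j lⱼ) i≢j+1)

    applyComparators-elsewhere : ∀ js c {i} → All Lower js → i < N → All (i ≢_) js → All (λ j → suc j ≢ i) js →
                                 applyComparators js c (at i) ≡ c (at i)
    applyComparators-elsewhere [] c _ _ _ _ = refl
    applyComparators-elsewhere (j ∷ js) c (lⱼ ∷ lower) i<N (i≢j ∷ i∉) (j+1≢i ∷ above) =
      trans (applyComparators-elsewhere js _ lower i<N i∉ above) (untouched c lⱼ i<N i≢j (≢-sym j+1≢i))

    applyComparators-lower : ∀ js c {j} → Unique js → All Lower js → j ∈ js →
                             applyComparators js c (at j) ≡ c (at j) ∧ c (at (suc j))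
    applyComparators-lower (j ∷ js) c (j∉ ∷ _) (lⱼ ∷ lower) (here refl) =
      trans (applyComparators-elsewhere js _ lower (lower<N lⱼ) j∉ (All.tabulate λ j′∈ → lower-apart (All.lookup lower j′∈) lⱼ))
            (compare-at-src c (at j) (at (suc j)))
    applyComparators-lower (k ∷ js) c {j} (k∉ ∷ js!) (lₖ ∷ lower) (there j∈) =
      trans (applyComparators-lower js _ js! lower j∈)
            (cong₂ _∧_ (untouched c lₖ (lower<N lⱼ) (∉⇒≢ k∉ j∈) (lower-apart lₖ lⱼ ∘ sym))
                       (untouched c lₖ (lowerEnd-bounded r j lⱼ) (lower-apart lⱼ lₖ) (∉⇒≢ k∉ j∈ ∘ suc-injective)))
      where lⱼ = All.lookup lower j∈

    applyComparators-upper : ∀ js c {j} → Unique js → All Lower js → j ∈ js →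
                             applyComparators js c (at (suc j)) ≡ c (at j) ∨ c (at (suc j))
    applyComparators-upper (j ∷ js) c (j∉ ∷ _) (lⱼ ∷ lower) (here refl) =
      trans (applyComparators-elsewhere js _ lower (lowerEnd-bounded r j lⱼ)
                                        (All.tabulate λ j+1∈ → lower-apart lⱼ (All.lookup lower j+1∈))
                                        (All.tabulate λ j′∈ → ∉⇒≢ j∉ j′∈ ∘ suc-injective))
            (compare-at-tgt c (at j) (at (suc j)) (at-≢ (lower<N lⱼ) (lowerEnd-bounded r j lⱼ) (<⇒≢ (n<1+n j))))
    applyComparators-upper (k ∷ js) c {j} (k∉ ∷ js!) (lₖ ∷ lower) (there j∈) =
      trans (applyComparators-upper js _ js! lower j∈)
            (cong₂ _∨_ (untouched c lₖ (lower<N lⱼ) (∉⇒≢ k∉ j∈) (lower-apart lₖ lⱼ ∘ sym))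
                       (untouched c lₖ (lowerEnd-bounded r j lⱼ) (lower-apart lⱼ lₖ) (∉⇒≢ k∉ j∈ ∘ suc-injective)))
      where lⱼ = All.lookup lower j∈

    applyComparators-round : ∀ js c → Unique js → All Lower js → (∀ {j} → Lower j → j ∈ js) →
                             ∀ i → i < N → applyComparators js c (at i) ≡ round r (c ∘ at) i
    applyComparators-round js c js! lower complete i i<N with lowerEnd r i in lᵢ
    ... | true = applyComparators-lower js c js! lower (complete lᵢ)
    ... | false = not-lower i i<N lᵢ
      where
      absent : ∀ {k} → lowerEnd r k ≡ false → All (k ≢_) js
      absent lₖ = All.tabulate λ j∈ k≡j → case trans (sym (All.lookup lower j∈)) (trans (cong (lowerEnd r) (sym k≡j)) lₖ) of λ ()
      not-lower : ∀ i → i < N → lowerEnd r i ≡ false →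
                  applyComparators js c (at i) ≡ (if upperEnd r i then c (at (pred i)) ∨ c (at i) else c (at i))
      not-lower zero i<N l₀ = applyComparators-elsewhere js c lower i<N (absent l₀) (All.tabulate λ _ ())
      not-lower (suc i) i<N lᵢ₊₁ with lowerEnd r i in lᵢ
      ... | true = applyComparators-upper js c js! lower (complete lᵢ)
      ... | false = applyComparators-elsewhere js c lower i<N (absent lᵢ₊₁)
                      (All.tabulate λ j∈ j+1≡i+1 → All.lookup (absent lᵢ) j∈ (sym (suc-injective j+1≡i+1)))

  phaseStages : List ℕ → List (Stage N)
  phaseStages [] = [] ∷ [] ∷ [] ∷ [] ∷ [] ∷ []
  phaseStages (j ∷ js) = zipWith _++_ (routeStages (routeAt j)) (phaseStages js)

  length-phaseStages : ∀ js → length (phaseStages js) ≡ 5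
  length-phaseStages [] = refl
  length-phaseStages (j ∷ js) = five (routeStages (routeAt j)) (phaseStages js) (length-routeStages (routeAt j)) (length-phaseStages js)
    where
    five : ∀ {A : Set} (xs ys : List (List A)) → length xs ≡ 5 → length ys ≡ 5 → length (zipWith _++_ xs ys) ≡ 5
    five (_ ∷ _ ∷ _ ∷ _ ∷ _ ∷ []) (_ ∷ _ ∷ _ ∷ _ ∷ _ ∷ []) refl refl = refl

  routeStages-within : ∀ R → All (EdgesWithin (_∈ vertices R)) (routeStages R)
  routeStages-within (route₁ a b) = ((here refl , there (here refl)) ∷ []) ∷ [] ∷ [] ∷ [] ∷ [] ∷ []
  routeStages-within (route₂ a x b) =
    ((here refl , there (here refl)) ∷ []) ∷ ((there (here refl) , there (there (here refl))) ∷ []) ∷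
    ((here refl , there (here refl)) ∷ []) ∷ [] ∷ [] ∷ []
  routeStages-within (route₃ a x y b) =
    ((here refl , there (here refl)) ∷ []) ∷ ((there (here refl) , there (there (here refl))) ∷ []) ∷
    ((there (there (here refl)) , there (there (there (here refl)))) ∷ []) ∷
    ((there (here refl) , there (there (here refl))) ∷ []) ∷ ((here refl , there (here refl)) ∷ []) ∷ []

  private
    single : ∀ {u v o} → E G u v → u ≢ v → IsDirectedMatching G (medge u v o ∷ [])
    single uv u≢v = uv ∷ [] , (u≢v ∷ []) ∷ [] ∷ []

    nothing : IsDirectedMatching G []
    nothing = [] , []

  routeStages-matchings : ∀ R → ValidRoute R → All (IsDirectedMatching G) (routeStages R)
  routeStages-matchings (route₁ a b) (ab , a≢b) = single ab a≢b ∷ nothing ∷ nothing ∷ nothing ∷ nothing ∷ []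
  routeStages-matchings (route₂ a x b) (ax , xb , a≢x , x≢b , _) =
    single ax a≢x ∷ single xb x≢b ∷ single ax a≢x ∷ nothing ∷ nothing ∷ []
  routeStages-matchings (route₃ a x y b) (ax , xy , yb , a≢x , _ , x≢y , _ , y≢b) =
    single ax a≢x ∷ single xy x≢y ∷ single yb y≢b ∷ single xy x≢y ∷ single ax a≢x ∷ []

  OnRoutes : List ℕ → V → Set
  OnRoutes js x = Any (λ j → x ∈ vertices (routeAt j)) js

  phaseStages-within : ∀ js → All (EdgesWithin (OnRoutes js)) (phaseStages js)
  phaseStages-within [] = [] ∷ [] ∷ [] ∷ [] ∷ [] ∷ []
  phaseStages-within (j ∷ js) = zipWith-++-within (All.map (EdgesWithin-mono here) (routeStages-within (routeAt j)))
                                                  (All.map (EdgesWithin-mono there) (phaseStages-within js))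

  private
    off-other-routes : ∀ {j js} → All (RoutesDisjoint j) js → ∀ {x} → x ∈ vertices (routeAt j) → OnRoutes js x → ⊥
    off-other-routes (apart ∷ _) x∈ (here x∈′) = apart (x∈ , x∈′)
    off-other-routes (_ ∷ aparts) x∈ (there on) = off-other-routes aparts x∈ on

  runᵇ-phaseStages : ∀ js c → All (λ j → suc j < N) js → AllPairs RoutesDisjoint js →
                     runᵇ (phaseStages js) c ≗ applyComparators js c
  runᵇ-phaseStages [] c _ _ _ = refl
  runᵇ-phaseStages (j ∷ js) c (j+1<N ∷ bounded) (apart ∷ aparts) w = begin
    runᵇ (zipWith _++_ (routeStages (routeAt j)) (phaseStages js)) c w
      ≡⟨ runᵇ-zipWith-++ c _ _ (within-apart⇒interleavable (off-other-routes apart) (routeStages-within (routeAt j))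
                                                        (phaseStages-within js))
                         (trans (length-routeStages (routeAt j)) (sym (length-phaseStages js))) w ⟩
    runᵇ (phaseStages js) (runᵇ (routeStages (routeAt j)) c) w
      ≡⟨ runᵇ-cong (runᵇ-routeStages (routeAt j) (routeAt-valid j j+1<N) c) (phaseStages js) w ⟩
    runᵇ (phaseStages js) (applyEdgeᵇ c (compareEdge (start (routeAt j)) (end (routeAt j)))) w
      ≡⟨ cong (λ e → runᵇ (phaseStages js) (applyEdgeᵇ c e) w) (routeAt-ends j j+1<N) ⟩
    runᵇ (phaseStages js) (applyEdgeᵇ c (comparatorAt j)) w
      ≡⟨ runᵇ-phaseStages js _ bounded aparts w ⟩
    applyComparators (j ∷ js) c w ∎
    where open ≡-Reasoning

  phaseStages-matchings : ∀ js → All (λ j → suc j < N) js → AllPairs RoutesDisjoint js →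
                          All (IsDirectedMatching G) (phaseStages js)
  phaseStages-matchings [] _ _ = nothing ∷ nothing ∷ nothing ∷ nothing ∷ nothing ∷ []
  phaseStages-matchings (j ∷ js) (j+1<N ∷ bounded) (apart ∷ aparts) =
    zipWith-++-matchings (off-other-routes apart) {H = G} (routeStages-matchings (routeAt j) (routeAt-valid j j+1<N))
                         (phaseStages-matchings js bounded aparts) (routeStages-within (routeAt j)) (phaseStages-within js)

  module Round (r : Bool) where
    open ComparatorsOfRound r

    Selected : ℕ → ℕ → Set
    Selected φ j = Lower j × colourAt j ≡ φ

    selected? : ∀ φ j → Dec (Selected φ j)
    selected? φ j = (lowerEnd r j ≟ᵇ true) ×-dec (colourAt j ℕ.≟ φ)

    phase : ℕ → List ℕ
    phase φ = filter (selected? φ) (upTo N)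

    private
      selected : ∀ {φ j} → j ∈ phase φ → Selected φ j
      selected {φ} j∈ = proj₂ (∈-filter⁻ (selected? φ) {xs = upTo N} j∈)

      selected-bounded : ∀ {φ} → All (λ j → suc j < N) (phase φ)
      selected-bounded = All.tabulate λ j∈ → lowerEnd-bounded r _ (proj₁ (selected j∈))

      selected-apart : ∀ φ → AllPairs RoutesDisjoint (phase φ)
      selected-apart φ = AllPairs-tabulate (Unique.filter⁺ (selected? φ) (Unique.upTo⁺ N)) λ i∈ j∈ i≢j →
        routes-disjoint (lowerEnd-bounded r _ (proj₁ (selected i∈))) (lowerEnd-bounded r _ (proj₁ (selected j∈))) i≢j
                        (trans (proj₂ (selected i∈)) (sym (proj₂ (selected j∈))))

    comparators : List ℕ
    comparators = concatMap phase (upTo colours)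

    stages : List (Stage N)
    stages = concatMap (phaseStages ∘ phase) (upTo colours)

    runᵇ-stages-sequential : ∀ φs c → runᵇ (concatMap (phaseStages ∘ phase) φs) c ≗ applyComparators (concatMap phase φs) c
    runᵇ-stages-sequential [] c _ = refl
    runᵇ-stages-sequential (φ ∷ φs) c w = begin
      runᵇ (phaseStages (phase φ) ++ concatMap (phaseStages ∘ phase) φs) c w
        ≡⟨ cong (λ d → d w) (runᵇ-++ (phaseStages (phase φ)) _ c) ⟩
      runᵇ (concatMap (phaseStages ∘ phase) φs) (runᵇ (phaseStages (phase φ)) c) w
        ≡⟨ runᵇ-stages-sequential φs _ w ⟩
      applyComparators (concatMap phase φs) (runᵇ (phaseStages (phase φ)) c) w
        ≡⟨ applyStageᵇ-cong (runᵇ-phaseStages (phase φ) c selected-bounded (selected-apart φ)) (map comparatorAt (concatMap phase φs)) w ⟩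
      applyComparators (concatMap phase φs) (applyComparators (phase φ) c) w
        ≡⟨ cong (λ d → d w) (applyStageᵇ-++ c (map comparatorAt (phase φ)) _) ⟨
      applyStageᵇ c (map comparatorAt (phase φ) ++ map comparatorAt (concatMap phase φs)) w
        ≡⟨ cong (λ s → applyStageᵇ c s w) (map-++ comparatorAt (phase φ) _) ⟨
      applyComparators (phase φ ++ concatMap phase φs) c w ∎
      where open ≡-Reasoning

    comparators-unique : Unique comparators
    comparators-unique = concatMap-unique phase (Unique.upTo⁺ colours)
      (All.tabulate λ {φ} _ → Unique.filter⁺ (selected? φ) (Unique.upTo⁺ N))
      (λ _ _ φ≢φ′ (j∈ , j∈′) → φ≢φ′ (trans (sym (proj₂ (selected j∈))) (proj₂ (selected j∈′))))

    comparators-lower : All Lower comparators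
    comparators-lower = All.tabulate λ j∈ → let _ , _ , j∈φ = find (∈-concatMap⁻ phase {xs = upTo colours} j∈) in proj₁ (selected j∈φ)

    comparators-complete : ∀ {j} → Lower j → j ∈ comparators
    comparators-complete {j} lⱼ = ∈-concatMap⁺ phase
      (lose (∈-upTo⁺ (subst (_< colours) (sym (colourAt-linkAt j j+1<N)) (colour<colours (linkAt j j+1<N))))
            (∈-filter⁺ (selected? _) (∈-upTo⁺ (<-trans (n<1+n j) j+1<N)) (lⱼ , refl)))
      where j+1<N = lowerEnd-bounded r j lⱼ

    runᵇ-stages : ∀ c i → i < N → runᵇ stages c (at i) ≡ round r (c ∘ at) i
    runᵇ-stages c i i<N = trans (runᵇ-stages-sequential (upTo colours) c (at i))
      (applyComparators-round comparators c comparators-unique comparators-lower comparators-complete i i<N)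

    stages-matchings : All (IsDirectedMatching G) stages
    stages-matchings = concatMap-All (upTo colours) λ φ → phaseStages-matchings (phase φ) selected-bounded (selected-apart φ)
      where
      concatMap-All : ∀ φs → (∀ φ → All (IsDirectedMatching G) (phaseStages (phase φ))) →
                      All (IsDirectedMatching G) (concatMap (phaseStages ∘ phase) φs)
      concatMap-All [] _ = []
      concatMap-All (φ ∷ φs) h = AllP.++⁺ (h φ) (concatMap-All φs h)

    length-stages : length stages ≡ colours * 5
    length-stages = trans (length-concatMap (upTo colours)) (cong (_* 5) (length-upTo colours))
      where
      length-concatMap : ∀ φs → length (concatMap (phaseStages ∘ phase) φs) ≡ length φs * 5
      length-concatMap [] = refl
      length-concatMap (φ ∷ φs) = trans (length-++ (phaseStages (phase φ)))
                                        (cong₂ _+_ (length-phaseStages (phase φ)) (length-concatMap φs))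

  sortStages : ℕ → List (Stage N)
  sortStages zero = []
  sortStages (suc t) = sortStages t ++ Round.stages false ++ Round.stages true

  round-local : ∀ r (x y : Line) → (∀ j → j < N → x j ≡ y j) → ∀ i → i < N → round r x i ≡ round r y i
  round-local r x y x≡y i i<N with lowerEnd r i in lᵢ
  ... | true rewrite x≡y i i<N | x≡y (suc i) (lowerEnd-bounded r i lᵢ) = refl
  ... | false = not-lower i i<N
    where
    not-lower : ∀ i → i < N → (if upperEnd r i then x (pred i) ∨ x i else x i) ≡ (if upperEnd r i then y (pred i) ∨ y i else y i)
    not-lower zero 0<N = x≡y 0 0<N
    not-lower (suc i) i<N rewrite x≡y i (<-trans (n<1+n i) i<N) | x≡y (suc i) i<N = refl

  runᵇ-sortStages : ∀ t c i → i < N → runᵇ (sortStages t) c (at i) ≡ doubleRounds t (c ∘ at) i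
  runᵇ-sortStages zero c i _ = refl
  runᵇ-sortStages (suc t) c i i<N = begin
    runᵇ (sortStages t ++ Round.stages false ++ Round.stages true) c (at i)
      ≡⟨ cong (λ d → d (at i)) (runᵇ-++ (sortStages t) _ c) ⟩
    runᵇ (Round.stages false ++ Round.stages true) d (at i)
      ≡⟨ cong (λ d′ → d′ (at i)) (runᵇ-++ (Round.stages false) _ d) ⟩
    runᵇ (Round.stages true) (runᵇ (Round.stages false) d) (at i)
      ≡⟨ Round.runᵇ-stages true _ i i<N ⟩
    round true (runᵇ (Round.stages false) d ∘ at) i
      ≡⟨ round-local true _ _ (λ j j<N → trans (Round.runᵇ-stages false d j j<N)
                                                (round-local false _ _ (runᵇ-sortStages t c) j j<N)) i i<N ⟩
    doubleRounds (suc t) (c ∘ at) i ∎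
    where
    open ≡-Reasoning
    d = runᵇ (sortStages t) c

  sortStages-matchings : ∀ t → All (IsDirectedMatching G) (sortStages t)
  sortStages-matchings zero = []
  sortStages-matchings (suc t) =
    AllP.++⁺ (sortStages-matchings t) (AllP.++⁺ (Round.stages-matchings false) (Round.stages-matchings true))

  length-sortStages : ∀ t → length (sortStages t) ≡ t * (colours * 5 + colours * 5)
  length-sortStages zero = refl
  length-sortStages (suc t) = begin
    length (sortStages t ++ Round.stages false ++ Round.stages true)
      ≡⟨ length-++ (sortStages t) ⟩
    length (sortStages t) + length (Round.stages false ++ Round.stages true)
      ≡⟨ cong₂ _+_ (length-sortStages t) (trans (length-++ (Round.stages false))
                                                (cong₂ _+_ (Round.length-stages false) (Round.length-stages true))) ⟩
    t * (colours * 5 + colours * 5) + (colours * 5 + colours * 5)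
      ≡⟨ +-comm _ (colours * 5 + colours * 5) ⟩
    suc t * (colours * 5 + colours * 5) ∎
    where open ≡-Reasoning

  -- each edge is swapped twice, which changes nothing but puts it in the network
  edgeTwice : V → V → List (Stage N)
  edgeTwice u v = if adj G u v then (swapEdge u v ∷ []) ∷ (swapEdge u v ∷ []) ∷ [] else []

  coverStages : List (Stage N)
  coverStages = concatMap (λ u → concatMap (edgeTwice u) (allFin N)) (allFin N)

  runᵇ-coverStages : ∀ c → runᵇ coverStages c ≗ c
  runᵇ-coverStages = runᵇ-concatMap-identity (λ u → concatMap (edgeTwice u) (allFin N)) (λ u → runᵇ-concatMap-identity (edgeTwice u) twice (allFin N)) (allFin N)
    where
    twice : ∀ {u} v c → runᵇ (edgeTwice u v) c ≗ c
    twice {u} v c with adj G u v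
    ... | true = swap-twice c u v
    ... | false = λ _ → refl

  coverStages-matchings : All (IsDirectedMatching G) coverStages
  coverStages-matchings = AllP.concat⁺ (AllP.map⁺ (All.universal (λ u →
    AllP.concat⁺ (AllP.map⁺ (All.universal (twice u) (allFin N)))) (allFin N)))
    where
    twice : ∀ u v → All (IsDirectedMatching G) (edgeTwice u v)
    twice u v with adj G u v in uv
    ... | true = single uv (adjacent-≢ uv) ∷ single uv (adjacent-≢ uv) ∷ []
      where
      adjacent-≢ : E G u v → u ≢ v
      adjacent-≢ uv refl with trans (sym uv) (Graph.irrefl G u)
      ... | ()
    ... | false = []

  coverStages-covers : ∀ u v → E G u v → Any (Any (IsEdge u v)) coverStages
  coverStages-covers u v uv =
    AnyP.concatMap⁺ (λ u → concatMap (edgeTwice u) (allFin N)) (lose (∈-allFin u) (AnyP.concatMap⁺ (edgeTwice u) (lose (∈-allFin v) hit)))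
    where
    hit : Any (Any (IsEdge u v)) (edgeTwice u v)
    hit rewrite uv = here (here (inj₁ (refl , refl)))

  length-coverStages : length coverStages ≤ N * (2 * Δ)
  length-coverStages = begin
    length coverStages                   ≤⟨ length-concatMap≤ (λ u → concatMap (edgeTwice u) (allFin N)) (λ u → ≤-trans (≤-reflexive (length-edges u (allFin N)))
                                                                               (*-monoʳ-≤ 2 (degree≤Δ u))) (allFin N) ⟩
    length (allFin N) * (2 * Δ)          ≡⟨ cong (_* (2 * Δ)) (length-tabulate (λ (v : V) → v)) ⟩
    N * (2 * Δ)                          ∎
    where
    open ≤-Reasoning
    length-edges : ∀ u xs → length (concatMap (edgeTwice u) xs) ≡ 2 * sum (map (bit ∘ adj G u) xs)
    length-edges u [] = refl
    length-edges u (x ∷ xs) with adj G u x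
    ... | true = trans (cong (2 +_) (length-edges u xs)) (sym (*-distribˡ-+ 2 1 _))
    ... | false = length-edges u xs

  rankOf : V → Fin N
  rankOf v = fromℕ< (proj₁ (proj₂ (position v)))

  toℕ-rankOf-at : ∀ i → i < N → toℕ (rankOf (at i)) ≡ i
  toℕ-rankOf-at i i<N =
    trans (toℕ-fromℕ< _) (at-injective (proj₁ (proj₂ (position (at i)))) i<N (proj₂ (proj₂ (position (at i)))))

  order : Permutation′ N
  order = permutation rankOf (at ∘ toℕ) (λ i → toℕ-injective (toℕ-rankOf-at (toℕ i) (toℕ<n i)))
                                        (λ v → trans (cong at (toℕ-fromℕ< _)) (proj₂ (proj₂ (position v))))

  networkStages : List (Stage N)
  networkStages = sortStages (N + N) ++ coverStages

  module Sorting (σ : Permutation′ N) where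

    rankAt : ℕ → ℕ
    rankAt j = toℕ (σ ⟨$⟩ʳ at j)

    private
      rankAt-injective : ∀ i j → i < N → j < N → rankAt i ≡ rankAt j → i ≡ j
      rankAt-injective i j i<N j<N rank≡ = at-injective i<N j<N
        (trans (sym (inverseˡ σ)) (trans (cong (σ ⟨$⟩ˡ_) (toℕ-injective rank≡)) (inverseˡ σ)))

      rankAt-surjective : ∀ k → k < N → ∃ λ j → j < N × rankAt j ≡ k
      rankAt-surjective k k<N with position (σ ⟨$⟩ˡ fromℕ< k<N)
      ... | j , j<N , at≡ = j , j<N , trans (cong (λ v → toℕ (σ ⟨$⟩ʳ v)) at≡) (trans (cong toℕ (inverseʳ σ)) (toℕ-fromℕ< k<N))

    open RankCounting N rankAt (λ j _ → toℕ<n (σ ⟨$⟩ʳ at j)) rankAt-injective rankAt-surjective using (atLeast; atLeast-value)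

    module _ (k : ℕ) where

      input : BoolConfig N
      input = threshold k ∘ (σ ⟨$⟩ʳ_)

      open OddEvenTranspositionSort.Progress N (input ∘ at) using (sorted-is-step)

      runᵇ-network-at : ∀ j → j < N → runᵇ networkStages input (at j) ≡ threshold k (order ⟨$⟩ʳ at j)
      runᵇ-network-at j j<N = begin
        runᵇ networkStages input (at j)                          ≡⟨ cong (λ d → d (at j)) (runᵇ-++ (sortStages (N + N)) _ input) ⟩
        runᵇ coverStages (runᵇ (sortStages (N + N)) input) (at j) ≡⟨ runᵇ-coverStages _ (at j) ⟩
        runᵇ (sortStages (N + N)) input (at j)                   ≡⟨ runᵇ-sortStages (N + N) input j j<N ⟩
        doubleRounds (N + N) (input ∘ at) j                      ≡⟨ sorted-is-step j j<N ⟩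
        (N ∸ atLeast k ≤ᵇ j)                                     ≡⟨ cong (λ K → N ∸ K ≤ᵇ j) (atLeast-value k) ⟩
        (N ∸ (N ∸ k) ≤ᵇ j)                                       ≡⟨ ∸∸-≤ᵇ {k = k} j<N ⟩
        (k ≤ᵇ j)                                                 ≡⟨ cong (k ≤ᵇ_) (toℕ-rankOf-at j j<N) ⟨
        threshold k (order ⟨$⟩ʳ at j)                             ∎
        where open ≡-Reasoning

      runᵇ-network : ∀ v → runᵇ networkStages input v ≡ threshold k (order ⟨$⟩ʳ v)
      runᵇ-network v = subst (λ w → runᵇ networkStages input w ≡ threshold k (order ⟨$⟩ʳ w)) at≡ (runᵇ-network-at j j<N)
        where
        j = proj₁ (position v)
        j<N = proj₁ (proj₂ (position v))
        at≡ = proj₂ (proj₂ (position v))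

    network-sorts : ∀ v → run networkStages (σ ⟨$⟩ʳ_) v ≡ order ⟨$⟩ʳ v
    network-sorts v = threshold-injective λ k →
      trans (threshold-run k {c′ = input k} (λ _ → refl) networkStages v) (runᵇ-network k v)

  network : SortingNetwork G
  network = record
    { H = G
    ; spanning = λ _ _ uv → uv
    ; connected = conn
    ; π = order
    ; M = networkStages
    ; matchings = AllP.++⁺ (sortStages-matchings (N + N)) coverStages-matchings
    ; sorts = Sorting.network-sorts
    ; covers = λ u v uv → AnyP.++⁺ʳ (sortStages (N + N)) (coverStages-covers u v uv)
    }

  depth-network : depth network ≤ 182 * (N * Δ)
  depth-network = begin
    length (sortStages (N + N) ++ coverStages)                          ≡⟨ length-++ (sortStages (N + N)) ⟩
    length (sortStages (N + N)) + length coverStages                    ≤⟨ +-monoʳ-≤ _ length-coverStages ⟩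
    length (sortStages (N + N)) + N * (2 * Δ)                           ≡⟨ cong (_+ N * (2 * Δ)) (length-sortStages (N + N)) ⟩
    (N + N) * (9 * Δ * 5 + 9 * Δ * 5) + N * (2 * Δ)                     ≡⟨ count-stages N Δ ⟩
    182 * (N * Δ)                                                       ∎
    where
    open ≤-Reasoning
    count-stages : ∀ N Δ → (N + N) * (9 * Δ * 5 + 9 * Δ * 5) + N * (2 * Δ) ≡ 182 * (N * Δ)
    count-stages = solve-∀

maxDegree≤ : ∀ {n} (G : Graph n) → maxDegree G ≤ n
maxDegree≤ {n} G = maximum≤ (degree G) degree≤ (allFin n)
  where
  degree≤ : ∀ v → degree G v ≤ n
  degree≤ v = subst (degree G v ≤_) (length-tabulate (λ (u : Fin n) → u)) (sum-bits≤length (adj G v) (allFin n))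

n*d≤d*d*n : ∀ n d → n * d ≤ d * d * n
n*d≤d*d*n n zero = ≤-reflexive (*-zeroʳ n)
n*d≤d*d*n n (suc d) = ≤-trans (≤-reflexive (*-comm n (suc d))) (*-monoˡ-≤ n (m≤m*n (suc d) (suc d)))

emptyNetwork : (G : Graph 0) → SortingNetwork G
emptyNetwork G = record
  { H = G ; spanning = λ _ _ uv → uv ; connected = λ () ; π = Permutation.id ; M = []
  ; matchings = [] ; sorts = λ _ () ; covers = λ () }

mainTheorem8 : Σ ℕ (λ c → ∀ (n : ℕ) (T : Graph n) → IsTree T →
                 StAtMost T (c * ((maxDegree T * maxDegree T * n) ⊓ (n * n))))
mainTheorem8 = 182 , bound
  where
  open TourNetwork using (network; depth-network)
  bound : ∀ (n : ℕ) (T : Graph n) → IsTree T → StAtMost T (182 * ((maxDegree T * maxDegree T * n) ⊓ (n * n)))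
  bound zero T _ = emptyNetwork T , z≤n
  bound (suc n) T (connected , _) =
    network T connected ,
    ≤-trans (depth-network T connected)
            (*-monoʳ-≤ 182 (⊓-glb (n*d≤d*d*n (suc n) (maxDegree T)) (*-monoʳ-≤ (suc n) (maxDegree≤ T))))
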